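{- Fix integers $n\ge 1$ and $0\le m\le N$, where $N=\binom{n}{2}$. For every integer $i\ge 1$, the square matrices $D_0, D_1, D_{i-1}, D_i, D_{i+1}$ (indexed by isomorphism classes of graphs with $n$ vertices and $m$ edges) satisfy \[ D_1D_i=(m-i+1)(N-m-i+1)D_{i-1} + i(N-2i)D_i + (i+1)^2D_{i+1}. \]
   Context: All graphs are simple (no loops, no multiple edges). For a graph $G$ on a fixed set of $n$ vertices with $m$ edges, $G^c$ denotes its complement and $N=\binom{n}{2}$. For an integer $j\ge 0$, the perturbed $j$-deck $PD_j(G)$ is the multiset of graphs $G-X+Y$, where $X$ ranges over all $j$-subsets of $E(G)$ and $Y$ ranges over all $j$-subsets of $E(G^c)$ (so the removed and added edge sets are disjoint); every such graph again has $n$ vertices and $m$ edges. Let $G_1,G_2,\dots$ be representatives of the isomorphism classes of graphs with $n$ vertices and $m$ edges. $D_j$ is the square matrix whose $(k,l)$ entry is the number of members of $PD_j(G_l)$ isomorphic to $G_k$ (this is the zero matrix if $j>\min(m,N-m)$); in particular $D_0$ is the identity matrix. Products are ordinary matrix products. -}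

module Defs where

open import Data.Bool using (Bool; true; false; _∧_; _∨_; not; if_then_else_)
open import Data.Nat using (ℕ; zero; suc; _<ᵇ_; _≡ᵇ_)
open import Data.Fin using (Fin; toℕ)
open import Data.Fin.Subset using (Subset; ∁; _∩_; _∪_; ∣_∣)
open import Data.List using (List; []; _∷_; length; concatMap; map; filterᵇ; allFin; foldr; cartesianProduct)
open import Data.Bool.ListAction using (all; any)
import Data.List as L
open import Data.Vec using (Vec; []; _∷_; lookup; toList; zipWith)
open import Data.Product using (_×_; _,_; proj₁; proj₂)
open import Data.Integer using (ℤ) renaming (_+_ to _+ℤ_; _*_ to _*ℤ_)
import Data.Integer as ℤ

-- Graphs on the vertex set Fin n.
-- The potential edges ("slots") are the pairs (u , v) with u < v.
-- A graph is the subset of slots that are edges.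

slots : (n : ℕ) → List (Fin n × Fin n)
slots n = concatMap (λ u → concatMap (λ v → if toℕ u <ᵇ toℕ v then (u , v) ∷ [] else []) (allFin n)) (allFin n)

-- number of slots (equals n choose 2)
S : ℕ → ℕ
S n = length (slots n)

record Graph (n : ℕ) : Set where
  constructor mkGraph
  field
    edgeSet : Subset (S n)

open Graph public

slot : ∀ {n} → Fin (S n) → Fin n × Fin n
slot {n} = L.lookup (slots n)

edges : ∀ {n} → Graph n → ℕ
edges G = ∣ edgeSet G ∣

compl : ∀ {n} → Graph n → Graph n
compl G = mkGraph (∁ (edgeSet G))

_==F_ : ∀ {n} → Fin n → Fin n → Bool
u ==F v = toℕ u ≡ᵇ toℕ v

adj : ∀ {n} → Graph n → Fin n → Fin n → Bool
adj {n} G u v = any (λ k → lookup (edgeSet G) k ∧ matches (slot {n} k)) (allFin (S n))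
  where
  matches : Fin n × Fin n → Bool
  matches (a , b) = ((a ==F u) ∧ (b ==F v)) ∨ ((a ==F v) ∧ (b ==F u))

-- Isomorphism: there is a bijection σ of Fin n (enumerated as a vector
-- of images; an injective self-map of Fin n is a bijection) with
-- adj G (σ u) (σ v) = adj H u v for all u v.

allVecs : ∀ {A : Set} → List A → (k : ℕ) → List (Vec A k)
allVecs xs zero = [] ∷ []
allVecs xs (suc k) = concatMap (λ x → map (x ∷_) (allVecs xs k)) xs

_==B_ : Bool → Bool → Bool
true ==B b = b
false ==B b = not b

injective? : ∀ {n} → Vec (Fin n) n → Bool
injective? {n} σ = all (λ u → all (λ v → not (lookup σ u ==F lookup σ v) ∨ (u ==F v)) (allFin n)) (allFin n)

isIso? : ∀ {n} → Vec (Fin n) n → Graph n → Graph n → Bool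
isIso? {n} σ G H = injective? σ ∧
  all (λ u → all (λ v → adj G (lookup σ u) (lookup σ v) ==B adj H u v) (allFin n)) (allFin n)

iso? : ∀ {n} → Graph n → Graph n → Bool
iso? {n} G H = any (λ σ → isIso? σ G H) (allVecs (allFin n) n)

allSubsets : (k : ℕ) → List (Subset k)
allSubsets k = allVecs (true ∷ false ∷ []) k

_⊆?_ : ∀ {k} → Subset k → Subset k → Bool
_⊆?_ {k} X Y = all (λ i → not (lookup X i) ∨ lookup Y i) (allFin k)

perturb : ∀ {n} → Graph n → Subset (S n) → Subset (S n) → Graph n
perturb G X Y = mkGraph ((edgeSet G ∩ ∁ X) ∪ Y)

count : ∀ {A : Set} → (A → Bool) → List A → ℕ
count p xs = length (filterᵇ p xs)

-- number of members of PD_j(G) isomorphic to F: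
-- pairs (X , Y), X a j-subset of E(G), Y a j-subset of E(G^c),
-- with G - X + Y ≅ F.
deckCount : ∀ {n} → ℕ → Graph n → Graph n → ℕ
deckCount {n} j F G =
  count (λ XY → let X = proj₁ XY ; Y = proj₂ XY in
                 (X ⊆? edgeSet G) ∧ (Y ⊆? edgeSet (compl G)) ∧ (∣ X ∣ ≡ᵇ j) ∧ (∣ Y ∣ ≡ᵇ j)
                 ∧ iso? (perturb G X Y) F)
        (cartesianProduct (allSubsets (S n)) (allSubsets (S n)))

-- Isomorphism classes of graphs with n vertices and m edges, via
-- representatives: keep the first graph of each class in enumeration order.

graphsWith : (n m : ℕ) → List (Graph n)
graphsWith n m = filterᵇ (λ G → edges G ≡ᵇ m) (map mkGraph (allSubsets (S n)))

repsFrom : ∀ {n} → List (Graph n) → List (Graph n) → List (Graph n)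
repsFrom acc [] = L.reverse acc
repsFrom acc (G ∷ Gs) = if any (λ H → iso? H G) acc then repsFrom acc Gs else repsFrom (G ∷ acc) Gs

classes : (n m : ℕ) → List (Graph n)
classes n m = repsFrom [] (graphsWith n m)

classCount : ℕ → ℕ → ℕ
classCount n m = length (classes n m)

rep : ∀ {n m} → Fin (classCount n m) → Graph n
rep {n} {m} = L.lookup (classes n m)

Matrix : ℕ → Set
Matrix c = Fin c → Fin c → ℤ

_⊗_ : ∀ {c} → Matrix c → Matrix c → Matrix c
_⊗_ {c} A B k l = foldr _+ℤ_ (ℤ.+ 0) (map (λ r → A k r *ℤ B r l) (allFin c))

_⊕_ : ∀ {c} → Matrix c → Matrix c → Matrix c
(A ⊕ B) k l = A k l +ℤ B k l

_⊙_ : ∀ {c} → ℤ → Matrix c → Matrix c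
(a ⊙ A) k l = a *ℤ A k l

D : (n m j : ℕ) → Matrix (classCount n m)
D n m j k l = ℤ.+ (deckCount j (rep {n} {m} k) (rep {n} {m} l))

-- The (k, l) entry of D₁Dᵢ counts pairs (H, Z) of edge sets with E(G_l) ⇝ᵢ H ⇝₁ Z and Z ≅ G_k,
-- where A ⇝ⱼ B means that B arises from A by deleting j edges and adding j non-edges. Two facts
-- make this precise: (X, Y) ↦ (A ∖ X) ∪ Y is a bijection from the pairs X ⊆ A, Y ⊆ Aᶜ onto all
-- edge sets, which turns deck counts into sums over edge sets; and the 1-deck count is invariant
-- under isomorphism, so it may be evaluated at H instead of at the representative of its class.
-- Exchanging the sums, it remains to count, for E = E(G_l) and a fixed Z with q = |E ∖ Z| and
-- r = |Z ∖ E|, the ways to delete an edge e ∈ Z and add a non-edge f ∉ Z so that the result is an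
-- i-perturbation of E. This forces q = r ∈ {i − 1, i, i + 1}, and sorting (e, f) by membership in E
-- gives (m − i + 1)(N − m − i + 1), i(N − 2i) and (i + 1)² choices respectively.

module Submission where

open import Defs

module Counting where

  import Algebra.Properties.CommutativeSemigroup as CommutativeSemigroupProperties
  open import Data.Bool using (Bool; true; false; _∧_; _∨_; not; T)
  open import Data.Bool.ListAction using (and)
  open import Data.Empty using (⊥-elim)
  open import Data.Fin using (Fin; zero; suc)
  open import Data.Fin.Subset using (Subset; ∣_∣; ⁅_⁆; ⊥)
  open import Data.List using (List; []; _∷_; map; allFin; tabulate; cartesianProduct; _++_; reverse; [_]; length)
  import Data.List as List
  open import Data.List.Membership.Propositional using (_∈_)
  open import Data.List.Properties using (map-tabulate; unfold-reverse)
  open import Data.List.Relation.Unary.Any using (here; there)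
  open import Data.Nat using (ℕ; zero; suc; _+_; _*_; _≤_; _≡ᵇ_; z≤n; s≤s)
  open import Data.Nat.Properties
    using (+-identityʳ; +-assoc; +-comm; *-zeroʳ; *-distribˡ-+; +-commutativeSemigroup; +-*-semiring; ≤-trans; m≤n+m; suc-injective)
  open import Algebra.Properties.Semiring.Sum +-*-semiring using (sum; sum-cong-≗; ∑-distrib-+; *-distribˡ-sum; *-distribʳ-sum)
  open import Data.Nat.Tactic.RingSolver using (solve-∀)
  open import Data.Product using (_×_; _,_)
  open import Data.Vec using ([]; _∷_; lookup)
  open import Data.Bool.Properties using (T-≡)
  open import Function using (_∘_; id)
  open import Function.Bundles using (Equivalence)
  open import Relation.Binary.PropositionalEquality hiding ([_])
  open import Relation.Nullary using (¬_)
  open ≡-Reasoning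

  private
    variable
      A B : Set
      k : ℕ

  ¬T⇒≡false : ∀ {b} → ¬ T b → b ≡ false
  ¬T⇒≡false {true} ¬t = ⊥-elim (¬t _)
  ¬T⇒≡false {false} _ = refl

  T-ext : ∀ {a b} → (T a → T b) → (T b → T a) → a ≡ b
  T-ext {true} {true} _ _ = refl
  T-ext {true} {false} a⇒b _ = ⊥-elim (a⇒b _)
  T-ext {false} {true} _ b⇒a = ⊥-elim (b⇒a _)
  T-ext {false} {false} _ _ = refl

  ⟦_⟧ : Bool → ℕ
  ⟦ true ⟧ = 1
  ⟦ false ⟧ = 0

  ⟦∧⟧ : ∀ a b → ⟦ a ∧ b ⟧ ≡ ⟦ a ⟧ * ⟦ b ⟧
  ⟦∧⟧ true b = sym (+-identityʳ ⟦ b ⟧)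
  ⟦∧⟧ false b = refl

  +-interchange : ∀ a b c d → (a + b) + (c + d) ≡ (a + c) + (b + d)
  +-interchange = CommutativeSemigroupProperties.interchange +-commutativeSemigroup

  sumMap : (A → ℕ) → List A → ℕ
  sumMap f [] = 0
  sumMap f (x ∷ xs) = f x + sumMap f xs

  sumMap-cong : {f g : A → ℕ} → (∀ x → f x ≡ g x) → ∀ xs → sumMap f xs ≡ sumMap g xs
  sumMap-cong f≗g [] = refl
  sumMap-cong f≗g (x ∷ xs) = cong₂ _+_ (f≗g x) (sumMap-cong f≗g xs)

  sumMap-++ : (f : A → ℕ) (xs ys : List A) → sumMap f (xs ++ ys) ≡ sumMap f xs + sumMap f ys
  sumMap-++ f [] ys = refl
  sumMap-++ f (x ∷ xs) ys = trans (cong (f x +_) (sumMap-++ f xs ys)) (sym (+-assoc (f x) _ _))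

  sumMap-map : (f : B → ℕ) (g : A → B) (xs : List A) → sumMap f (map g xs) ≡ sumMap (f ∘ g) xs
  sumMap-map f g [] = refl
  sumMap-map f g (x ∷ xs) = cong (f (g x) +_) (sumMap-map f g xs)

  sumMap-*ˡ : (c : ℕ) (f : A → ℕ) (xs : List A) → sumMap (λ x → c * f x) xs ≡ c * sumMap f xs
  sumMap-*ˡ c f [] = sym (*-zeroʳ c)
  sumMap-*ˡ c f (x ∷ xs) = trans (cong (c * f x +_) (sumMap-*ˡ c f xs)) (sym (*-distribˡ-+ c (f x) _))

  sumMap-cartesianProduct : (f : A × B → ℕ) (xs : List A) (ys : List B) →
    sumMap f (cartesianProduct xs ys) ≡ sumMap (λ x → sumMap (λ y → f (x , y)) ys) xs
  sumMap-cartesianProduct f [] ys = refl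
  sumMap-cartesianProduct f (x ∷ xs) ys = trans (sumMap-++ f (map (x ,_) ys) _)
    (cong₂ _+_ (sumMap-map f (x ,_) ys) (sumMap-cartesianProduct f xs ys))

  sumMap-reverse : (f : A → ℕ) (xs : List A) → sumMap f (reverse xs) ≡ sumMap f xs
  sumMap-reverse f [] = refl
  sumMap-reverse f (x ∷ xs) = begin
    sumMap f (reverse (x ∷ xs))      ≡⟨ cong (sumMap f) (unfold-reverse x xs) ⟩
    sumMap f (reverse xs ++ [ x ])   ≡⟨ sumMap-++ f (reverse xs) [ x ] ⟩
    sumMap f (reverse xs) + (f x + 0) ≡⟨ cong₂ _+_ (sumMap-reverse f xs) (+-identityʳ (f x)) ⟩
    sumMap f xs + f x                ≡⟨ +-comm (sumMap f xs) (f x) ⟩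
    f x + sumMap f xs                ∎

  sumMap-tabulate : ∀ {c} (f : A → ℕ) (g : Fin c → A) → sumMap f (tabulate g) ≡ sum (f ∘ g)
  sumMap-tabulate {c = zero} f g = refl
  sumMap-tabulate {c = suc c} f g = cong (f (g zero) +_) (sumMap-tabulate f (g ∘ suc))

  count≡sumMap : (p : A → Bool) (xs : List A) → count p xs ≡ sumMap (λ x → ⟦ p x ⟧) xs
  count≡sumMap p [] = refl
  count≡sumMap p (x ∷ xs) with p x
  ... | true = cong suc (count≡sumMap p xs)
  ... | false = count≡sumMap p xs

  sumSubsets : (Subset k → ℕ) → ℕ
  sumSubsets {zero} f = f []
  sumSubsets {suc k} f = sumSubsets (f ∘ (true ∷_)) + sumSubsets (f ∘ (false ∷_))

  sumSubsets-cong : {f g : Subset k → ℕ} → (∀ Z → f Z ≡ g Z) → sumSubsets f ≡ sumSubsets g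
  sumSubsets-cong {zero} f≗g = f≗g []
  sumSubsets-cong {suc k} f≗g = cong₂ _+_ (sumSubsets-cong (f≗g ∘ (true ∷_))) (sumSubsets-cong (f≗g ∘ (false ∷_)))

  sumSubsets-+ : (f g : Subset k → ℕ) → sumSubsets (λ Z → f Z + g Z) ≡ sumSubsets f + sumSubsets g
  sumSubsets-+ {zero} f g = refl
  sumSubsets-+ {suc k} f g = trans
    (cong₂ _+_ (sumSubsets-+ (f ∘ (true ∷_)) (g ∘ (true ∷_))) (sumSubsets-+ (f ∘ (false ∷_)) (g ∘ (false ∷_))))
    (+-interchange (sumSubsets (f ∘ (true ∷_))) (sumSubsets (g ∘ (true ∷_)))
                   (sumSubsets (f ∘ (false ∷_))) (sumSubsets (g ∘ (false ∷_))))

  sumSubsets-*ˡ : (c : ℕ) (f : Subset k → ℕ) → sumSubsets (λ Z → c * f Z) ≡ c * sumSubsets f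
  sumSubsets-*ˡ {zero} c f = refl
  sumSubsets-*ˡ {suc k} c f = trans (cong₂ _+_ (sumSubsets-*ˡ c (f ∘ (true ∷_))) (sumSubsets-*ˡ c (f ∘ (false ∷_))))
    (sym (*-distribˡ-+ c _ _))

  sumSubsets-zero : ∀ k → sumSubsets {k} (λ _ → 0) ≡ 0
  sumSubsets-zero zero = refl
  sumSubsets-zero (suc k) = cong₂ _+_ (sumSubsets-zero k) (sumSubsets-zero k)

  sumSubsets-comm : ∀ {l} (f : Subset k → Subset l → ℕ) →
    sumSubsets (λ X → sumSubsets (f X)) ≡ sumSubsets (λ Y → sumSubsets (λ X → f X Y))
  sumSubsets-comm {zero} f = refl
  sumSubsets-comm {suc k} f = trans (cong₂ _+_ (sumSubsets-comm (f ∘ (true ∷_))) (sumSubsets-comm (f ∘ (false ∷_))))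
    (sym (sumSubsets-+ (λ Y → sumSubsets (λ X → f (true ∷ X) Y)) (λ Y → sumSubsets (λ X → f (false ∷ X) Y))))

  sumMap-sumSubsets : (f : A → Subset k → ℕ) (xs : List A) →
    sumMap (λ x → sumSubsets (f x)) xs ≡ sumSubsets (λ Z → sumMap (λ x → f x Z) xs)
  sumMap-sumSubsets {k = k} f [] = sym (sumSubsets-zero k)
  sumMap-sumSubsets f (x ∷ xs) = trans (cong (sumSubsets (f x) +_) (sumMap-sumSubsets f xs))
    (sym (sumSubsets-+ (f x) (λ Z → sumMap (λ y → f y Z) xs)))

  sumMap-allSubsets : (f : Subset k → ℕ) → sumMap f (allSubsets k) ≡ sumSubsets f
  sumMap-allSubsets {zero} f = +-identityʳ (f [])
  sumMap-allSubsets {suc k} f = begin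
    sumMap f (map (true ∷_) (allSubsets k) ++ (map (false ∷_) (allSubsets k) ++ []))
      ≡⟨ sumMap-++ f (map (true ∷_) (allSubsets k)) _ ⟩
    sumMap f (map (true ∷_) (allSubsets k)) + sumMap f (map (false ∷_) (allSubsets k) ++ [])
      ≡⟨ cong₂ _+_ (sumMap-map f (true ∷_) (allSubsets k))
                   (trans (sumMap-++ f (map (false ∷_) (allSubsets k)) []) (trans (+-identityʳ _) (sumMap-map f (false ∷_) (allSubsets k)))) ⟩
    sumMap (f ∘ (true ∷_)) (allSubsets k) + sumMap (f ∘ (false ∷_)) (allSubsets k)
      ≡⟨ cong₂ _+_ (sumMap-allSubsets (f ∘ (true ∷_))) (sumMap-allSubsets (f ∘ (false ∷_))) ⟩
    sumSubsets f ∎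

  sumSubsetsOf : Subset k → (Subset k → ℕ) → ℕ
  sumSubsetsOf [] f = f []
  sumSubsetsOf (true ∷ G) f = sumSubsetsOf G (f ∘ (true ∷_)) + sumSubsetsOf G (f ∘ (false ∷_))
  sumSubsetsOf (false ∷ G) f = sumSubsetsOf G (f ∘ (false ∷_))

  sumSubsetsOf-cong : (G : Subset k) {f g : Subset k → ℕ} → (∀ X → f X ≡ g X) → sumSubsetsOf G f ≡ sumSubsetsOf G g
  sumSubsetsOf-cong [] f≗g = f≗g []
  sumSubsetsOf-cong (true ∷ G) f≗g = cong₂ _+_ (sumSubsetsOf-cong G (f≗g ∘ (true ∷_))) (sumSubsetsOf-cong G (f≗g ∘ (false ∷_)))
  sumSubsetsOf-cong (false ∷ G) f≗g = sumSubsetsOf-cong G (f≗g ∘ (false ∷_))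

  sumSubsetsOf-+ : (G : Subset k) (f g : Subset k → ℕ) →
    sumSubsetsOf G (λ X → f X + g X) ≡ sumSubsetsOf G f + sumSubsetsOf G g
  sumSubsetsOf-+ [] f g = refl
  sumSubsetsOf-+ (true ∷ G) f g = trans
    (cong₂ _+_ (sumSubsetsOf-+ G (f ∘ (true ∷_)) (g ∘ (true ∷_))) (sumSubsetsOf-+ G (f ∘ (false ∷_)) (g ∘ (false ∷_))))
    (+-interchange (sumSubsetsOf G (f ∘ (true ∷_))) (sumSubsetsOf G (g ∘ (true ∷_)))
                   (sumSubsetsOf G (f ∘ (false ∷_))) (sumSubsetsOf G (g ∘ (false ∷_))))
  sumSubsetsOf-+ (false ∷ G) f g = sumSubsetsOf-+ G (f ∘ (false ∷_)) (g ∘ (false ∷_))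

  sumSubsetsOf-*ˡ : (G : Subset k) (c : ℕ) (f : Subset k → ℕ) → sumSubsetsOf G (λ X → c * f X) ≡ c * sumSubsetsOf G f
  sumSubsetsOf-*ˡ [] c f = refl
  sumSubsetsOf-*ˡ (true ∷ G) c f = trans
    (cong₂ _+_ (sumSubsetsOf-*ˡ G c (f ∘ (true ∷_))) (sumSubsetsOf-*ˡ G c (f ∘ (false ∷_))))
    (sym (*-distribˡ-+ c _ _))
  sumSubsetsOf-*ˡ (false ∷ G) c f = sumSubsetsOf-*ˡ G c (f ∘ (false ∷_))

  ⊆?-cons : ∀ x (X : Subset k) g G → ((x ∷ X) ⊆? (g ∷ G)) ≡ (not x ∨ g) ∧ (X ⊆? G)
  ⊆?-cons {k} x X g G = cong (λ l → (not x ∨ g) ∧ and l) (trans (map-tabulate suc p) (sym (map-tabulate id (p ∘ suc))))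
    where
    p : Fin (suc k) → Bool
    p i = not (lookup (x ∷ X) i) ∨ lookup (g ∷ G) i

  sumSubsets-⊆? : (G : Subset k) (f : Subset k → ℕ) → sumSubsets (λ X → ⟦ X ⊆? G ⟧ * f X) ≡ sumSubsetsOf G f
  sumSubsets-⊆? [] f = +-identityʳ (f [])
  sumSubsets-⊆? (true ∷ G) f = cong₂ _+_
    (trans (sumSubsets-cong (λ X → cong (λ b → ⟦ b ⟧ * f (true ∷ X)) (⊆?-cons true X true G))) (sumSubsets-⊆? G _))
    (trans (sumSubsets-cong (λ X → cong (λ b → ⟦ b ⟧ * f (false ∷ X)) (⊆?-cons false X true G))) (sumSubsets-⊆? G _))
  sumSubsets-⊆? {suc k} (false ∷ G) f = cong₂ _+_
    (trans (sumSubsets-cong (λ X → cong (λ b → ⟦ b ⟧ * f (true ∷ X)) (⊆?-cons true X false G))) (sumSubsets-zero k))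
    (trans (sumSubsets-cong (λ X → cong (λ b → ⟦ b ⟧ * f (false ∷ X)) (⊆?-cons false X false G))) (sumSubsets-⊆? G _))

  sumSubsetsOf-zero : (G : Subset k) → sumSubsetsOf G (λ _ → 0) ≡ 0
  sumSubsetsOf-zero [] = refl
  sumSubsetsOf-zero (true ∷ G) = cong₂ _+_ (sumSubsetsOf-zero G) (sumSubsetsOf-zero G)
  sumSubsetsOf-zero (false ∷ G) = sumSubsetsOf-zero G

  sumSubsetsOf-empty : (G : Subset k) (f : Subset k → ℕ) → sumSubsetsOf G (λ X → ⟦ ∣ X ∣ ≡ᵇ 0 ⟧ * f X) ≡ f ⊥
  sumSubsetsOf-empty [] f = +-identityʳ (f [])
  sumSubsetsOf-empty (true ∷ G) f = cong₂ _+_ (sumSubsetsOf-zero G) (sumSubsetsOf-empty G (f ∘ (false ∷_)))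
  sumSubsetsOf-empty (false ∷ G) f = sumSubsetsOf-empty G (f ∘ (false ∷_))

  sumSubsetsOf-singletons : (G : Subset k) (f : Subset k → ℕ) →
    sumSubsetsOf G (λ X → ⟦ ∣ X ∣ ≡ᵇ 1 ⟧ * f X) ≡ sum (λ e → ⟦ lookup G e ⟧ * f ⁅ e ⁆)
  sumSubsetsOf-singletons [] f = refl
  sumSubsetsOf-singletons (true ∷ G) f = cong₂ _+_
    (trans (sumSubsetsOf-empty G (f ∘ (true ∷_))) (sym (+-identityʳ _)))
    (sumSubsetsOf-singletons G (f ∘ (false ∷_)))
  sumSubsetsOf-singletons (false ∷ G) f = sumSubsetsOf-singletons G (f ∘ (false ∷_))

  sum-sum-* : ∀ w (a b : Fin k → ℕ) → sum (λ e → sum (λ f → w * (a e * b f))) ≡ w * (sum a * sum b)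
  sum-sum-* w a b = begin
    sum (λ e → sum (λ f → w * (a e * b f))) ≡⟨ sum-cong-≗ (λ e → trans (sym (*-distribˡ-sum w (λ f → a e * b f)))
                                                                       (cong (w *_) (sym (*-distribˡ-sum (a e) b)))) ⟩
    sum (λ e → w * (a e * sum b))           ≡⟨ *-distribˡ-sum w (λ e → a e * sum b) ⟨
    w * sum (λ e → a e * sum b)             ≡⟨ cong (w *_) (*-distribʳ-sum (sum b) a) ⟨
    w * (sum a * sum b)                     ∎

  sum-+₄ : (t₁ t₂ t₃ t₄ : Fin k → ℕ) →
    sum (λ e → t₁ e + (t₂ e + (t₃ e + t₄ e))) ≡ sum t₁ + (sum t₂ + (sum t₃ + sum t₄))
  sum-+₄ t₁ t₂ t₃ t₄ = begin
    sum (λ e → t₁ e + (t₂ e + (t₃ e + t₄ e)))        ≡⟨ ∑-distrib-+ t₁ (λ e → t₂ e + (t₃ e + t₄ e)) ⟩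
    sum t₁ + sum (λ e → t₂ e + (t₃ e + t₄ e))        ≡⟨ cong (sum t₁ +_) (∑-distrib-+ t₂ (λ e → t₃ e + t₄ e)) ⟩
    sum t₁ + (sum t₂ + sum (λ e → t₃ e + t₄ e))      ≡⟨ cong (λ x → sum t₁ + (sum t₂ + x)) (∑-distrib-+ t₃ t₄) ⟩
    sum t₁ + (sum t₂ + (sum t₃ + sum t₄))            ∎

  sum-cells : (a b c d : Fin k → Bool) (φ : Bool → Bool → ℕ) →
    let count : (Fin k → Bool) → ℕ
        count p = sum (λ e → ⟦ p e ⟧) in
    sum (λ e → sum (λ f → ⟦ a e ⟧ * (⟦ b f ⟧ * φ (c e) (d f)))) ≡
      φ true true * (count (λ e → c e ∧ a e) * count (λ f → d f ∧ b f)) +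
      (φ true false * (count (λ e → c e ∧ a e) * count (λ f → not (d f) ∧ b f)) +
      (φ false true * (count (λ e → not (c e) ∧ a e) * count (λ f → d f ∧ b f)) +
      φ false false * (count (λ e → not (c e) ∧ a e) * count (λ f → not (d f) ∧ b f))))
  sum-cells {k} a b c d φ = begin
    _ ≡⟨ sum-cong-≗ (λ e → sum-cong-≗ (λ f → split (a e) (b f) (c e) (d f))) ⟩
    sum (λ e → sum (λ f → term₁ e f + (term₂ e f + (term₃ e f + term₄ e f))))
      ≡⟨ sum-cong-≗ (λ e → sum-+₄ (term₁ e) (term₂ e) (term₃ e) (term₄ e)) ⟩
    sum (λ e → sum (term₁ e) + (sum (term₂ e) + (sum (term₃ e) + sum (term₄ e))))
      ≡⟨ sum-+₄ (λ e → sum (term₁ e)) (λ e → sum (term₂ e)) (λ e → sum (term₃ e)) (λ e → sum (term₄ e)) ⟩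
    _ ≡⟨ cong₂ _+_ (sum-sum-* (φ true true) (λ e → ⟦ c e ∧ a e ⟧) (λ f → ⟦ d f ∧ b f ⟧))
         (cong₂ _+_ (sum-sum-* (φ true false) (λ e → ⟦ c e ∧ a e ⟧) (λ f → ⟦ not (d f) ∧ b f ⟧))
         (cong₂ _+_ (sum-sum-* (φ false true) (λ e → ⟦ not (c e) ∧ a e ⟧) (λ f → ⟦ d f ∧ b f ⟧))
                    (sum-sum-* (φ false false) (λ e → ⟦ not (c e) ∧ a e ⟧) (λ f → ⟦ not (d f) ∧ b f ⟧)))) ⟩
    _ ∎
    where
    term₁ term₂ term₃ term₄ : Fin k → Fin k → ℕ
    term₁ e f = φ true true * (⟦ c e ∧ a e ⟧ * ⟦ d f ∧ b f ⟧)
    term₂ e f = φ true false * (⟦ c e ∧ a e ⟧ * ⟦ not (d f) ∧ b f ⟧)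
    term₃ e f = φ false true * (⟦ not (c e) ∧ a e ⟧ * ⟦ d f ∧ b f ⟧)
    term₄ e f = φ false false * (⟦ not (c e) ∧ a e ⟧ * ⟦ not (d f) ∧ b f ⟧)
    onlyFirst : ∀ x y w₁ w₂ w₃ w₄ → x * (y * w₁) ≡ w₁ * (x * y) + (w₂ * (x * 0) + (w₃ * (0 * y) + w₄ * (0 * 0)))
    onlyFirst = solve-∀
    onlySecond : ∀ x y w₁ w₂ w₃ w₄ → x * (y * w₂) ≡ w₁ * (x * 0) + (w₂ * (x * y) + (w₃ * (0 * 0) + w₄ * (0 * y)))
    onlySecond = solve-∀
    onlyThird : ∀ x y w₁ w₂ w₃ w₄ → x * (y * w₃) ≡ w₁ * (0 * y) + (w₂ * (0 * 0) + (w₃ * (x * y) + w₄ * (x * 0)))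
    onlyThird = solve-∀
    onlyFourth : ∀ x y w₁ w₂ w₃ w₄ → x * (y * w₄) ≡ w₁ * (0 * 0) + (w₂ * (0 * y) + (w₃ * (x * 0) + w₄ * (x * y)))
    onlyFourth = solve-∀
    split : ∀ x y u v → ⟦ x ⟧ * (⟦ y ⟧ * φ u v) ≡
      φ true true * (⟦ u ∧ x ⟧ * ⟦ v ∧ y ⟧) + (φ true false * (⟦ u ∧ x ⟧ * ⟦ not v ∧ y ⟧) +
      (φ false true * (⟦ not u ∧ x ⟧ * ⟦ v ∧ y ⟧) + φ false false * (⟦ not u ∧ x ⟧ * ⟦ not v ∧ y ⟧)))
    split x y true  true  = onlyFirst  ⟦ x ⟧ ⟦ y ⟧ (φ true true) (φ true false) (φ false true) (φ false false)
    split x y true  false = onlySecond ⟦ x ⟧ ⟦ y ⟧ (φ true true) (φ true false) (φ false true) (φ false false)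
    split x y false true  = onlyThird  ⟦ x ⟧ ⟦ y ⟧ (φ true true) (φ true false) (φ false true) (φ false false)
    split x y false false = onlyFourth ⟦ x ⟧ ⟦ y ⟧ (φ true true) (φ true false) (φ false true) (φ false false)

  sumMap-none : (p : A → Bool) (xs : List A) → (∀ {x} → x ∈ xs → ¬ T (p x)) → sumMap (λ x → ⟦ p x ⟧) xs ≡ 0
  sumMap-none p [] none = refl
  sumMap-none p (x ∷ xs) none rewrite ¬T⇒≡false (none (here refl)) = sumMap-none p xs (none ∘ there)

  sumMap-some : (p : A → Bool) {xs : List A} {x : A} → x ∈ xs → T (p x) → 1 ≤ sumMap (λ x → ⟦ p x ⟧) xs
  sumMap-some p {y ∷ xs} (here refl) t rewrite Equivalence.to T-≡ t = s≤s z≤n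
  sumMap-some p {y ∷ xs} (there x∈) t = ≤-trans (sumMap-some p x∈ t) (m≤n+m _ ⟦ p y ⟧)

  sumMap-unique : (p : A → Bool) (w : A → ℕ) {c : ℕ} (xs : List A) → sumMap (λ x → ⟦ p x ⟧) xs ≡ 1 →
    (∀ {x} → x ∈ xs → T (p x) → w x ≡ c) → sumMap (λ x → ⟦ p x ⟧ * w x) xs ≡ c
  sumMap-unique p w {c} (x ∷ xs) once w≡c with p x in px
  ... | true = trans (cong₂ _+_ (trans (+-identityʳ (w x)) (w≡c (here refl) (Equivalence.from T-≡ px))) (no-more xs (suc-injective once)))
                     (+-identityʳ c)
    where
    no-more : ∀ ys → sumMap (λ y → ⟦ p y ⟧) ys ≡ 0 → sumMap (λ y → ⟦ p y ⟧ * w y) ys ≡ 0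
    no-more [] _ = refl
    no-more (y ∷ ys) none with p y
    ... | false = no-more ys none
  ... | false = sumMap-unique p w xs once (w≡c ∘ there)

  sumMap-allFin-lookup : (h : A → ℕ) (xs : List A) → sumMap (h ∘ List.lookup xs) (allFin (length xs)) ≡ sumMap h xs
  sumMap-allFin-lookup h xs = trans (sumMap-tabulate (h ∘ List.lookup xs) id) (sum-lookup xs)
    where
    sum-lookup : ∀ xs → sum (h ∘ List.lookup xs) ≡ sumMap h xs
    sum-lookup [] = refl
    sum-lookup (x ∷ xs) = cong (h x +_) (sum-lookup xs)

module Perturbations where

  open Counting
  open import Data.Bool using (Bool; true; false; _∧_; _∨_; not; T)
  open import Data.Bool.Properties using (∧-comm; ∧-assoc; ∧-zeroʳ; ∧-identityʳ; ∨-zeroʳ; ∨-identityʳ; T-∧)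
  open import Data.Fin using (Fin; zero; suc)
  open import Data.Fin.Properties using (_≟_)
  open import Data.Fin.Subset using (Subset; ∁; _∩_; _∪_; ∣_∣; ⁅_⁆)
  open import Data.Fin.Subset.Properties using (∩-comm)
  open import Data.List using (cartesianProduct)
  open import Data.Nat using (ℕ; zero; suc; _+_; _*_; _≡ᵇ_)
  open import Data.Nat.Properties using (+-identityʳ; +-assoc; +-comm; +-suc; *-assoc; *-comm; +-cancelʳ-≡; +-*-semiring; ≡ᵇ⇒≡)
  open import Algebra.Properties.Semiring.Sum +-*-semiring using (sum; sum-cong-≗; *-distribˡ-sum)
  open import Data.Nat.Tactic.RingSolver using (solve-∀)
  open import Data.Product using (_×_; _,_; proj₁; proj₂)
  open import Data.Vec using (Vec; []; _∷_; lookup; _[_]≔_)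
  open import Data.Vec.Properties
    using (lookup-replicate; lookup-map; lookup-zipWith; lookup∘update; lookup∘update′; tabulate∘lookup; tabulate-cong)
  open import Function using (_∘_; case_of_)
  open import Function.Bundles using (Equivalence)
  open import Relation.Binary.PropositionalEquality hiding ([_])
  open import Relation.Nullary using (does; yes; no)
  open ≡-Reasoning

  private
    variable
      A : Set
      k : ℕ

  both≡ᵇ : ℕ → ℕ → ℕ → Bool
  both≡ᵇ a x y = (x ≡ᵇ a) ∧ (y ≡ᵇ a)

  infix 4 _⇝[_]_

  _⇝[_]_ : Subset k → ℕ → Subset k → Bool
  G ⇝[ j ] Z = both≡ᵇ j (∣ G ∩ ∁ Z ∣) (∣ Z ∩ ∁ G ∣)

  ⇝-sym : (G : Subset k) (j : ℕ) (Z : Subset k) → (G ⇝[ j ] Z) ≡ (Z ⇝[ j ] G)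
  ⇝-sym G j Z = ∧-comm (∣ G ∩ ∁ Z ∣ ≡ᵇ j) (∣ Z ∩ ∁ G ∣ ≡ᵇ j)

  -- (X, Y) ↦ (G ∖ X) ∪ Y is a bijection from X ⊆ G, Y ⊆ ∁ G onto all subsets Z,
  -- with |X| = |G ∖ Z| and |Y| = |Z ∖ G|.
  sumSubsetsOf-removeAdd : (G : Subset k) (h : Subset k → ℕ → ℕ → ℕ) →
    sumSubsetsOf G (λ X → sumSubsetsOf (∁ G) (λ Y → h ((G ∩ ∁ X) ∪ Y) ∣ X ∣ ∣ Y ∣)) ≡
    sumSubsets (λ Z → h Z ∣ G ∩ ∁ Z ∣ ∣ Z ∩ ∁ G ∣)
  sumSubsetsOf-removeAdd [] h = refl
  sumSubsetsOf-removeAdd (true ∷ G) h = trans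
    (cong₂ _+_ (sumSubsetsOf-removeAdd G (λ Z a b → h (false ∷ Z) (suc a) b))
               (sumSubsetsOf-removeAdd G (λ Z a b → h (true ∷ Z) a b)))
    (+-comm (sumSubsets (λ Z → h (false ∷ Z) (suc ∣ G ∩ ∁ Z ∣) ∣ Z ∩ ∁ G ∣))
            (sumSubsets (λ Z → h (true ∷ Z) ∣ G ∩ ∁ Z ∣ ∣ Z ∩ ∁ G ∣)))
  sumSubsetsOf-removeAdd (false ∷ G) h = trans
    (sumSubsetsOf-+ G (λ X → sumSubsetsOf (∁ G) (λ Y → h (true ∷ (G ∩ ∁ X) ∪ Y) ∣ X ∣ (suc ∣ Y ∣)))
                       (λ X → sumSubsetsOf (∁ G) (λ Y → h (false ∷ (G ∩ ∁ X) ∪ Y) ∣ X ∣ ∣ Y ∣)))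
    (cong₂ _+_ (sumSubsetsOf-removeAdd G (λ Z a b → h (true ∷ Z) a (suc b)))
               (sumSubsetsOf-removeAdd G (λ Z a b → h (false ∷ Z) a b)))

  deckCount≡sumSubsets : ∀ {n} j (F G : Graph n) →
    deckCount j F G ≡ sumSubsets (λ Z → ⟦ edgeSet G ⇝[ j ] Z ⟧ * ⟦ iso? (mkGraph Z) F ⟧)
  deckCount≡sumSubsets {n} j F G = begin
    deckCount j F G
      ≡⟨ count≡sumMap _ (cartesianProduct (allSubsets (S n)) (allSubsets (S n))) ⟩
    sumMap (λ XY → ⟦ pairOK (proj₁ XY) (proj₂ XY) ⟧) (cartesianProduct (allSubsets (S n)) (allSubsets (S n)))
      ≡⟨ sumMap-cartesianProduct _ (allSubsets (S n)) (allSubsets (S n)) ⟩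
    sumMap (λ X → sumMap (λ Y → ⟦ pairOK X Y ⟧) (allSubsets (S n))) (allSubsets (S n))
      ≡⟨ trans (sumMap-cong (λ X → sumMap-allSubsets (λ Y → ⟦ pairOK X Y ⟧)) (allSubsets (S n)))
               (sumMap-allSubsets (λ X → sumSubsets (λ Y → ⟦ pairOK X Y ⟧))) ⟩
    sumSubsets (λ X → sumSubsets (λ Y → ⟦ pairOK X Y ⟧))
      ≡⟨ sumSubsets-cong (λ X → trans (sumSubsets-cong (λ Y → ⟦∧⟧ (X ⊆? E) ((Y ⊆? ∁ E) ∧ rest X Y)))
                                      (sumSubsets-*ˡ ⟦ X ⊆? E ⟧ (λ Y → ⟦ (Y ⊆? ∁ E) ∧ rest X Y ⟧))) ⟩
    sumSubsets (λ X → ⟦ X ⊆? E ⟧ * sumSubsets (λ Y → ⟦ (Y ⊆? ∁ E) ∧ rest X Y ⟧))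
      ≡⟨ sumSubsets-⊆? E (λ X → sumSubsets (λ Y → ⟦ (Y ⊆? ∁ E) ∧ rest X Y ⟧)) ⟩
    sumSubsetsOf E (λ X → sumSubsets (λ Y → ⟦ (Y ⊆? ∁ E) ∧ rest X Y ⟧))
      ≡⟨ sumSubsetsOf-cong E (λ X → trans (sumSubsets-cong (λ Y → ⟦∧⟧ (Y ⊆? ∁ E) (rest X Y)))
                                         (sumSubsets-⊆? (∁ E) (λ Y → ⟦ rest X Y ⟧))) ⟩
    sumSubsetsOf E (λ X → sumSubsetsOf (∁ E) (λ Y → h ((E ∩ ∁ X) ∪ Y) ∣ X ∣ ∣ Y ∣))
      ≡⟨ sumSubsetsOf-removeAdd E h ⟩
    sumSubsets (λ Z → h Z ∣ E ∩ ∁ Z ∣ ∣ Z ∩ ∁ E ∣)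
      ≡⟨ sumSubsets-cong (λ Z →
           trans (cong ⟦_⟧ (sym (∧-assoc (∣ E ∩ ∁ Z ∣ ≡ᵇ j) (∣ Z ∩ ∁ E ∣ ≡ᵇ j) (iso? (mkGraph Z) F))))
                 (⟦∧⟧ (E ⇝[ j ] Z) (iso? (mkGraph Z) F))) ⟩
    sumSubsets (λ Z → ⟦ E ⇝[ j ] Z ⟧ * ⟦ iso? (mkGraph Z) F ⟧) ∎
    where
    E : Subset (S n)
    E = edgeSet G
    h : Subset (S n) → ℕ → ℕ → ℕ
    h Z a b = ⟦ (a ≡ᵇ j) ∧ ((b ≡ᵇ j) ∧ iso? (mkGraph Z) F) ⟧
    rest : Subset (S n) → Subset (S n) → Bool
    rest X Y = (∣ X ∣ ≡ᵇ j) ∧ ((∣ Y ∣ ≡ᵇ j) ∧ iso? (perturb G X Y) F)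
    pairOK : Subset (S n) → Subset (S n) → Bool
    pairOK X Y = (X ⊆? E) ∧ ((Y ⊆? ∁ E) ∧ rest X Y)

  swap : Subset k → Fin k → Fin k → Subset k
  swap Z e f = (Z [ e ]≔ false) [ f ]≔ true

  lookup-⁅⁆ : (e i : Fin k) → lookup ⁅ e ⁆ i ≡ does (e ≟ i)
  lookup-⁅⁆ zero zero = refl
  lookup-⁅⁆ zero (suc i) = lookup-replicate i false
  lookup-⁅⁆ (suc e) zero = refl
  lookup-⁅⁆ (suc e) (suc i) = lookup-⁅⁆ e i

  Vec-ext : {xs ys : Vec A k} → (∀ i → lookup xs i ≡ lookup ys i) → xs ≡ ys
  Vec-ext {xs = xs} {ys} eq = trans (sym (tabulate∘lookup xs)) (trans (tabulate-cong eq) (tabulate∘lookup ys))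

  perturb-singletons≡swap : (G : Subset k) (e f : Fin k) → (G ∩ ∁ ⁅ e ⁆) ∪ ⁅ f ⁆ ≡ swap G e f
  perturb-singletons≡swap G e f = Vec-ext pointwise
    where
    pointwise : ∀ i → lookup ((G ∩ ∁ ⁅ e ⁆) ∪ ⁅ f ⁆) i ≡ lookup (swap G e f) i
    pointwise i
      rewrite lookup-zipWith _∨_ i (G ∩ ∁ ⁅ e ⁆) ⁅ f ⁆ | lookup-zipWith _∧_ i G (∁ ⁅ e ⁆)
            | lookup-map i not ⁅ e ⁆ | lookup-⁅⁆ e i | lookup-⁅⁆ f i
      with f ≟ i | e ≟ i
    ... | yes refl | _ = trans (∨-zeroʳ _) (sym (lookup∘update f (G [ e ]≔ false) true))
    ... | no f≢i | yes refl = trans (∨-identityʳ _) (trans (∧-zeroʳ _)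
          (sym (trans (lookup∘update′ (f≢i ∘ sym) (G [ e ]≔ false) true) (lookup∘update e G false))))
    ... | no f≢i | no e≢i = trans (∨-identityʳ _) (trans (∧-identityʳ _)
          (sym (trans (lookup∘update′ (f≢i ∘ sym) (G [ e ]≔ false) true) (lookup∘update′ (e≢i ∘ sym) G false))))

  sumSubsets-oneSwap : (G : Subset k) (Q : Subset k → ℕ) →
    sumSubsets (λ Z → ⟦ G ⇝[ 1 ] Z ⟧ * Q Z) ≡
    sum (λ e → sum (λ f → ⟦ lookup G e ⟧ * (⟦ not (lookup G f) ⟧ * Q (swap G e f))))
  sumSubsets-oneSwap G Q = begin
    sumSubsets (λ Z → ⟦ G ⇝[ 1 ] Z ⟧ * Q Z)
      ≡⟨ sym (sumSubsetsOf-removeAdd G (λ Z a b → ⟦ both≡ᵇ 1 a b ⟧ * Q Z)) ⟩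
    sumSubsetsOf G (λ X → sumSubsetsOf (∁ G) (λ Y → ⟦ both≡ᵇ 1 ∣ X ∣ ∣ Y ∣ ⟧ * Q ((G ∩ ∁ X) ∪ Y)))
      ≡⟨ sumSubsetsOf-cong G (λ X →
           trans (sumSubsetsOf-cong (∁ G) (λ Y → splitCondition X Y))
                 (sumSubsetsOf-*ˡ (∁ G) ⟦ ∣ X ∣ ≡ᵇ 1 ⟧ (λ Y → ⟦ ∣ Y ∣ ≡ᵇ 1 ⟧ * Q ((G ∩ ∁ X) ∪ Y)))) ⟩
    sumSubsetsOf G (λ X → ⟦ ∣ X ∣ ≡ᵇ 1 ⟧ * sumSubsetsOf (∁ G) (λ Y → ⟦ ∣ Y ∣ ≡ᵇ 1 ⟧ * Q ((G ∩ ∁ X) ∪ Y)))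
      ≡⟨ sumSubsetsOf-singletons G (λ X → sumSubsetsOf (∁ G) (λ Y → ⟦ ∣ Y ∣ ≡ᵇ 1 ⟧ * Q ((G ∩ ∁ X) ∪ Y))) ⟩
    sum (λ e → ⟦ lookup G e ⟧ * sumSubsetsOf (∁ G) (λ Y → ⟦ ∣ Y ∣ ≡ᵇ 1 ⟧ * Q ((G ∩ ∁ ⁅ e ⁆) ∪ Y)))
      ≡⟨ sum-cong-≗ (λ e →
           trans (cong (⟦ lookup G e ⟧ *_) (sumSubsetsOf-singletons (∁ G) (λ Y → Q ((G ∩ ∁ ⁅ e ⁆) ∪ Y))))
                 (*-distribˡ-sum ⟦ lookup G e ⟧ (λ f → ⟦ lookup (∁ G) f ⟧ * Q ((G ∩ ∁ ⁅ e ⁆) ∪ ⁅ f ⁆)))) ⟩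
    sum (λ e → sum (λ f → ⟦ lookup G e ⟧ * (⟦ lookup (∁ G) f ⟧ * Q ((G ∩ ∁ ⁅ e ⁆) ∪ ⁅ f ⁆))))
      ≡⟨ sum-cong-≗ (λ e → sum-cong-≗ (λ f → cong₂ (λ b Z → ⟦ lookup G e ⟧ * (⟦ b ⟧ * Q Z))
                                                     (lookup-map f not G) (perturb-singletons≡swap G e f))) ⟩
    sum (λ e → sum (λ f → ⟦ lookup G e ⟧ * (⟦ not (lookup G f) ⟧ * Q (swap G e f)))) ∎
    where
    splitCondition : ∀ X Y →
      ⟦ both≡ᵇ 1 ∣ X ∣ ∣ Y ∣ ⟧ * Q ((G ∩ ∁ X) ∪ Y) ≡ ⟦ ∣ X ∣ ≡ᵇ 1 ⟧ * (⟦ ∣ Y ∣ ≡ᵇ 1 ⟧ * Q ((G ∩ ∁ X) ∪ Y))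
    splitCondition X Y = trans (cong (_* Q ((G ∩ ∁ X) ∪ Y)) (⟦∧⟧ (∣ X ∣ ≡ᵇ 1) (∣ Y ∣ ≡ᵇ 1)))
                               (*-assoc ⟦ ∣ X ∣ ≡ᵇ 1 ⟧ ⟦ ∣ Y ∣ ≡ᵇ 1 ⟧ (Q ((G ∩ ∁ X) ∪ Y)))

  ∣∷∣ : ∀ b (A : Subset k) → ∣ b ∷ A ∣ ≡ ⟦ b ⟧ + ∣ A ∣
  ∣∷∣ true A = refl
  ∣∷∣ false A = refl

  ∣[]≔∣ : (A : Subset k) (e : Fin k) (b : Bool) → ∣ A [ e ]≔ b ∣ + ⟦ lookup A e ⟧ ≡ ∣ A ∣ + ⟦ b ⟧
  ∣[]≔∣ (a ∷ A) zero b = begin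
    ∣ b ∷ A ∣ + ⟦ a ⟧     ≡⟨ cong (_+ ⟦ a ⟧) (∣∷∣ b A) ⟩
    ⟦ b ⟧ + ∣ A ∣ + ⟦ a ⟧ ≡⟨ exchange ⟦ b ⟧ ∣ A ∣ ⟦ a ⟧ ⟩
    ⟦ a ⟧ + ∣ A ∣ + ⟦ b ⟧ ≡⟨ cong (_+ ⟦ b ⟧) (∣∷∣ a A) ⟨
    ∣ a ∷ A ∣ + ⟦ b ⟧     ∎
    where
    exchange : ∀ x y z → x + y + z ≡ z + y + x
    exchange = solve-∀
  ∣[]≔∣ (a ∷ A) (suc e) b = begin
    ∣ a ∷ (A [ e ]≔ b) ∣ + ⟦ lookup A e ⟧     ≡⟨ cong (_+ ⟦ lookup A e ⟧) (∣∷∣ a (A [ e ]≔ b)) ⟩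
    ⟦ a ⟧ + ∣ A [ e ]≔ b ∣ + ⟦ lookup A e ⟧   ≡⟨ +-assoc ⟦ a ⟧ _ _ ⟩
    ⟦ a ⟧ + (∣ A [ e ]≔ b ∣ + ⟦ lookup A e ⟧) ≡⟨ cong (⟦ a ⟧ +_) (∣[]≔∣ A e b) ⟩
    ⟦ a ⟧ + (∣ A ∣ + ⟦ b ⟧)                   ≡⟨ +-assoc ⟦ a ⟧ _ _ ⟨
    ⟦ a ⟧ + ∣ A ∣ + ⟦ b ⟧                     ≡⟨ cong (_+ ⟦ b ⟧) (∣∷∣ a A) ⟨
    ∣ a ∷ A ∣ + ⟦ b ⟧                         ∎

  lookup-∩∁ : (A B : Subset k) (e : Fin k) → lookup (A ∩ ∁ B) e ≡ lookup A e ∧ not (lookup B e)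
  lookup-∩∁ (a ∷ A) (b ∷ B) zero = refl
  lookup-∩∁ (a ∷ A) (b ∷ B) (suc e) = lookup-∩∁ A B e

  ∩∁-[]≔ : (E Z : Subset k) (e : Fin k) (b : Bool) → E ∩ ∁ (Z [ e ]≔ b) ≡ (E ∩ ∁ Z) [ e ]≔ (lookup E e ∧ not b)
  ∩∁-[]≔ (g ∷ E) (z ∷ Z) zero b = refl
  ∩∁-[]≔ (g ∷ E) (z ∷ Z) (suc e) b = cong ((g ∧ not z) ∷_) (∩∁-[]≔ E Z e b)

  []≔-∩∁ : (E Z : Subset k) (e : Fin k) (b : Bool) → (Z [ e ]≔ b) ∩ ∁ E ≡ (Z ∩ ∁ E) [ e ]≔ (b ∧ not (lookup E e))
  []≔-∩∁ (g ∷ E) (z ∷ Z) zero b = refl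
  []≔-∩∁ (g ∷ E) (z ∷ Z) (suc e) b = cong ((z ∧ not g) ∷_) ([]≔-∩∁ E Z e b)

  ∣∩∁-[]≔∣ : (E Z : Subset k) (e : Fin k) (b : Bool) →
    ∣ E ∩ ∁ (Z [ e ]≔ b) ∣ + ⟦ lookup E e ∧ not (lookup Z e) ⟧ ≡ ∣ E ∩ ∁ Z ∣ + ⟦ lookup E e ∧ not b ⟧
  ∣∩∁-[]≔∣ E Z e b rewrite ∩∁-[]≔ E Z e b | sym (lookup-∩∁ E Z e) = ∣[]≔∣ (E ∩ ∁ Z) e (lookup E e ∧ not b)

  ∣[]≔-∩∁∣ : (E Z : Subset k) (e : Fin k) (b : Bool) →
    ∣ (Z [ e ]≔ b) ∩ ∁ E ∣ + ⟦ lookup Z e ∧ not (lookup E e) ⟧ ≡ ∣ Z ∩ ∁ E ∣ + ⟦ b ∧ not (lookup E e) ⟧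
  ∣[]≔-∩∁∣ E Z e b rewrite []≔-∩∁ E Z e b | sym (lookup-∩∁ Z E e) = ∣[]≔∣ (Z ∩ ∁ E) e (b ∧ not (lookup E e))

  lookup-removed : (Z : Subset k) {e f : Fin k} → lookup Z e ≡ true → lookup Z f ≡ false → lookup (Z [ e ]≔ false) f ≡ false
  lookup-removed Z {e} {f} Ze Zf = trans (lookup∘update′ f≢e Z false) Zf
    where
    f≢e : f ≢ e
    f≢e refl = case trans (sym Ze) Zf of λ ()

  swap-∣∩∁∣ : (E Z : Subset k) {e f : Fin k} → lookup Z e ≡ true → lookup Z f ≡ false →
    ∣ E ∩ ∁ (swap Z e f) ∣ + ⟦ lookup E f ⟧ ≡ ∣ E ∩ ∁ Z ∣ + ⟦ lookup E e ⟧
  swap-∣∩∁∣ E Z {e} {f} Ze Zf = begin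
    ∣ E ∩ ∁ (swap Z e f) ∣ + ⟦ lookup E f ⟧
      ≡⟨ subst₂ (λ x y → ∣ E ∩ ∁ (swap Z e f) ∣ + ⟦ x ⟧ ≡ ∣ E ∩ ∁ (Z [ e ]≔ false) ∣ + ⟦ y ⟧)
                (trans (cong (λ z → lookup E f ∧ not z) (lookup-removed Z Ze Zf)) (∧-identityʳ _)) (∧-zeroʳ _)
                (∣∩∁-[]≔∣ E (Z [ e ]≔ false) f true) ⟩
    ∣ E ∩ ∁ (Z [ e ]≔ false) ∣ + 0
      ≡⟨ subst₂ (λ x y → ∣ E ∩ ∁ (Z [ e ]≔ false) ∣ + ⟦ x ⟧ ≡ ∣ E ∩ ∁ Z ∣ + ⟦ y ⟧)
                (trans (cong (λ z → lookup E e ∧ not z) Ze) (∧-zeroʳ _)) (∧-identityʳ _)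
                (∣∩∁-[]≔∣ E Z e false) ⟩
    ∣ E ∩ ∁ Z ∣ + ⟦ lookup E e ⟧ ∎

  swap-∣∁∩∣ : (E Z : Subset k) {e f : Fin k} → lookup Z e ≡ true → lookup Z f ≡ false →
    ∣ swap Z e f ∩ ∁ E ∣ + ⟦ not (lookup E e) ⟧ ≡ ∣ Z ∩ ∁ E ∣ + ⟦ not (lookup E f) ⟧
  swap-∣∁∩∣ E Z {e} {f} Ze Zf = begin
    ∣ swap Z e f ∩ ∁ E ∣ + ⟦ not (lookup E e) ⟧
      ≡⟨ cong (_+ ⟦ not (lookup E e) ⟧) (trans (sym (+-identityʳ _))
           (subst (λ z → ∣ swap Z e f ∩ ∁ E ∣ + ⟦ z ∧ not (lookup E f) ⟧ ≡ ∣ (Z [ e ]≔ false) ∩ ∁ E ∣ + ⟦ not (lookup E f) ⟧)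
                  (lookup-removed Z Ze Zf) (∣[]≔-∩∁∣ E (Z [ e ]≔ false) f true))) ⟩
    ∣ (Z [ e ]≔ false) ∩ ∁ E ∣ + ⟦ not (lookup E f) ⟧ + ⟦ not (lookup E e) ⟧
      ≡⟨ +-right-comm ∣ (Z [ e ]≔ false) ∩ ∁ E ∣ ⟦ not (lookup E f) ⟧ ⟦ not (lookup E e) ⟧ ⟩
    ∣ (Z [ e ]≔ false) ∩ ∁ E ∣ + ⟦ not (lookup E e) ⟧ + ⟦ not (lookup E f) ⟧
      ≡⟨ cong (_+ ⟦ not (lookup E f) ⟧) (trans
           (subst (λ z → ∣ (Z [ e ]≔ false) ∩ ∁ E ∣ + ⟦ z ∧ not (lookup E e) ⟧ ≡ ∣ Z ∩ ∁ E ∣ + 0) Ze (∣[]≔-∩∁∣ E Z e false))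
           (+-identityʳ _)) ⟩
    ∣ Z ∩ ∁ E ∣ + ⟦ not (lookup E f) ⟧ ∎
    where
    +-right-comm : ∀ x y z → x + y + z ≡ x + z + y
    +-right-comm = solve-∀

  -- E ⇝ᵢ swap Z e f, by whether e and f are edges of E, in terms of q = |E ∖ Z| and r = |Z ∖ E|.
  swapCell : ℕ → ℕ → ℕ → Bool → Bool → Bool
  swapCell i q r true  true  = both≡ᵇ i q r
  swapCell i q r true  false = both≡ᵇ i (suc q) (suc r)
  swapCell i q r false true  = both≡ᵇ (suc i) q r
  swapCell i q r false false = both≡ᵇ i q r

  +0≡+1 : ∀ {x y} → x + 0 ≡ y + 1 → x ≡ suc y
  +0≡+1 {x} {y} eq = trans (sym (+-identityʳ x)) (trans eq (+-comm y 1))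

  both≡ᵇ-shift : ∀ i {q r q′ r′} ge gf → q′ + ⟦ gf ⟧ ≡ q + ⟦ ge ⟧ → r′ + ⟦ not ge ⟧ ≡ r + ⟦ not gf ⟧ →
    both≡ᵇ i q′ r′ ≡ swapCell i q r ge gf
  both≡ᵇ-shift i true  true  eq eq′ rewrite +-cancelʳ-≡ 1 _ _ eq | +-cancelʳ-≡ 0 _ _ eq′ = refl
  both≡ᵇ-shift i true  false eq eq′ rewrite +0≡+1 eq | +0≡+1 eq′ = refl
  both≡ᵇ-shift i false true  eq eq′ rewrite +0≡+1 (sym eq) | +0≡+1 (sym eq′) = refl
  both≡ᵇ-shift i false false eq eq′ rewrite +-cancelʳ-≡ 0 _ _ eq | +-cancelʳ-≡ 1 _ _ eq′ = refl

  swap-⇝ : (E Z : Subset k) (i : ℕ) {e f : Fin k} → lookup Z e ≡ true → lookup Z f ≡ false →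
    (E ⇝[ i ] swap Z e f) ≡ swapCell i (∣ E ∩ ∁ Z ∣) (∣ Z ∩ ∁ E ∣) (lookup E e) (lookup E f)
  swap-⇝ E Z i {e} {f} Ze Zf = both≡ᵇ-shift i (lookup E e) (lookup E f) (swap-∣∩∁∣ E Z Ze Zf) (swap-∣∁∩∣ E Z Ze Zf)

  count≡∣∩∣ : (A B : Subset k) {a b : Fin k → Bool} → (∀ e → lookup A e ≡ a e) → (∀ e → lookup B e ≡ b e) →
    sum (λ e → ⟦ a e ∧ b e ⟧) ≡ ∣ A ∩ B ∣
  count≡∣∩∣ A B A≗a B≗b =
    sym (trans (∣∩∣≡sum A B) (sum-cong-≗ (λ e → cong₂ (λ x y → ⟦ x ∧ y ⟧) (A≗a e) (B≗b e))))
    where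
    ∣∩∣≡sum : ∀ {k} (A B : Subset k) → ∣ A ∩ B ∣ ≡ sum (λ e → ⟦ lookup A e ∧ lookup B e ⟧)
    ∣∩∣≡sum [] [] = refl
    ∣∩∣≡sum (a ∷ A) (b ∷ B) = trans (∣∷∣ (a ∧ b) (A ∩ B)) (cong (⟦ a ∧ b ⟧ +_) (∣∩∣≡sum A B))

  twoStepCount : ℕ → ℕ → ℕ → ℕ → ℕ → ℕ
  twoStepCount i p q r t =
    ⟦ both≡ᵇ i q r ⟧ * (p * q) + (⟦ both≡ᵇ i (suc q) (suc r) ⟧ * (p * t) +
    (⟦ both≡ᵇ (suc i) q r ⟧ * (r * q) + ⟦ both≡ᵇ i q r ⟧ * (r * t)))

  sumSubsets-twoStep : (E Z : Subset k) (i : ℕ) →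
    sumSubsets (λ H → ⟦ E ⇝[ i ] H ⟧ * ⟦ H ⇝[ 1 ] Z ⟧) ≡
    twoStepCount i (∣ E ∩ Z ∣) (∣ E ∩ ∁ Z ∣) (∣ Z ∩ ∁ E ∣) (∣ ∁ E ∩ ∁ Z ∣)
  sumSubsets-twoStep E Z i = begin
    sumSubsets (λ H → ⟦ E ⇝[ i ] H ⟧ * ⟦ H ⇝[ 1 ] Z ⟧)
      ≡⟨ sumSubsets-cong (λ H → trans (*-comm ⟦ E ⇝[ i ] H ⟧ _) (cong (λ b → ⟦ b ⟧ * ⟦ E ⇝[ i ] H ⟧) (⇝-sym H 1 Z))) ⟩
    sumSubsets (λ H → ⟦ Z ⇝[ 1 ] H ⟧ * ⟦ E ⇝[ i ] H ⟧)
      ≡⟨ sumSubsets-oneSwap Z (λ H → ⟦ E ⇝[ i ] H ⟧) ⟩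
    sum (λ e → sum (λ f → ⟦ lookup Z e ⟧ * (⟦ not (lookup Z f) ⟧ * ⟦ E ⇝[ i ] swap Z e f ⟧)))
      ≡⟨ sum-cong-≗ (λ e → sum-cong-≗ (λ f → onSwaps e f)) ⟩
    sum (λ e → sum (λ f → ⟦ lookup Z e ⟧ * (⟦ not (lookup Z f) ⟧ * cell (lookup E e) (lookup E f))))
      ≡⟨ sum-cells (lookup Z) (not ∘ lookup Z) (lookup E) (lookup E) cell ⟩
    cells inBoth onlyE onlyZ inNeither
      ≡⟨ trans (cong₂ (λ p q → cells p q onlyZ inNeither) (count≡∣∩∣ E Z (λ _ → refl) (λ _ → refl))
                                              (count≡∣∩∣ E (∁ Z) (λ _ → refl) (λ f → lookup-map f not Z)))
               (cong₂ (cells (∣ E ∩ Z ∣) (∣ E ∩ ∁ Z ∣))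
                      (trans (count≡∣∩∣ (∁ E) Z (λ e → lookup-map e not E) (λ _ → refl)) (cong ∣_∣ (∩-comm (∁ E) Z)))
                      (count≡∣∩∣ (∁ E) (∁ Z) (λ e → lookup-map e not E) (λ f → lookup-map f not Z))) ⟩
    twoStepCount i (∣ E ∩ Z ∣) (∣ E ∩ ∁ Z ∣) (∣ Z ∩ ∁ E ∣) (∣ ∁ E ∩ ∁ Z ∣) ∎
    where
    cell : Bool → Bool → ℕ
    cell ge gf = ⟦ swapCell i (∣ E ∩ ∁ Z ∣) (∣ Z ∩ ∁ E ∣) ge gf ⟧
    cells : ℕ → ℕ → ℕ → ℕ → ℕ
    cells a b c d = cell true true * (a * b) + (cell true false * (a * d) + (cell false true * (c * b) + cell false false * (c * d)))
    inBoth onlyE onlyZ inNeither : ℕ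
    inBoth = sum (λ e → ⟦ lookup E e ∧ lookup Z e ⟧)
    onlyE = sum (λ e → ⟦ lookup E e ∧ not (lookup Z e) ⟧)
    onlyZ = sum (λ e → ⟦ not (lookup E e) ∧ lookup Z e ⟧)
    inNeither = sum (λ e → ⟦ not (lookup E e) ∧ not (lookup Z e) ⟧)
    onSwaps : ∀ e f → ⟦ lookup Z e ⟧ * (⟦ not (lookup Z f) ⟧ * ⟦ E ⇝[ i ] swap Z e f ⟧) ≡
                      ⟦ lookup Z e ⟧ * (⟦ not (lookup Z f) ⟧ * cell (lookup E e) (lookup E f))
    onSwaps e f with lookup Z e in Ze | lookup Z f in Zf
    ... | false | _     = refl
    ... | true  | true  = refl
    ... | true  | false = cong (λ b → 1 * (1 * ⟦ b ⟧)) (swap-⇝ E Z i Ze Zf)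

  ∣∩∣+∣∩∁∣ : (A B : Subset k) → ∣ A ∩ B ∣ + ∣ A ∩ ∁ B ∣ ≡ ∣ A ∣
  ∣∩∣+∣∩∁∣ [] [] = refl
  ∣∩∣+∣∩∁∣ (true ∷ A) (true ∷ B) = cong suc (∣∩∣+∣∩∁∣ A B)
  ∣∩∣+∣∩∁∣ (true ∷ A) (false ∷ B) = trans (+-suc _ _) (cong suc (∣∩∣+∣∩∁∣ A B))
  ∣∩∣+∣∩∁∣ (false ∷ A) (b ∷ B) = ∣∩∣+∣∩∁∣ A B

  ∣∣+∣∁∣ : (A : Subset k) → ∣ A ∣ + ∣ ∁ A ∣ ≡ k
  ∣∣+∣∁∣ [] = refl
  ∣∣+∣∁∣ (true ∷ A) = cong suc (∣∣+∣∁∣ A)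
  ∣∣+∣∁∣ (false ∷ A) = trans (+-suc _ _) (cong suc (∣∣+∣∁∣ A))

  both≡ᵇ⇒≡ : ∀ a x y → both≡ᵇ a x y ≡ true → x ≡ a × y ≡ a
  both≡ᵇ⇒≡ a x y eq = let tx , ty = Equivalence.to T-∧ (subst T (sym eq) _) in ≡ᵇ⇒≡ x a tx , ≡ᵇ⇒≡ y a ty

  ⇝-preserves-∣∣ : (E H : Subset k) (j : ℕ) → (E ⇝[ j ] H) ≡ true → ∣ H ∣ ≡ ∣ E ∣
  ⇝-preserves-∣∣ E H j E⇝H = begin
    ∣ H ∣                     ≡⟨ ∣∩∣+∣∩∁∣ H E ⟨
    ∣ H ∩ E ∣ + ∣ H ∩ ∁ E ∣   ≡⟨ cong₂ _+_ (cong ∣_∣ (∩-comm H E)) (trans (proj₂ removed,added) (sym (proj₁ removed,added))) ⟩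
    ∣ E ∩ H ∣ + ∣ E ∩ ∁ H ∣   ≡⟨ ∣∩∣+∣∩∁∣ E H ⟩
    ∣ E ∣                     ∎
    where
    removed,added : ∣ E ∩ ∁ H ∣ ≡ j × ∣ H ∩ ∁ E ∣ ≡ j
    removed,added = both≡ᵇ⇒≡ j ∣ E ∩ ∁ H ∣ ∣ H ∩ ∁ E ∣ E⇝H

module Slots where

  open Counting
  open import Data.Bool using (Bool; true; false; _∧_; _∨_; if_then_else_; T)
  open import Data.Bool.ListAction using (any; or)
  open import Data.Bool.Properties using (T-∧; T-∨; T-≡; ∧-identityʳ; ∨-identityʳ)
  open import Data.Empty using (⊥-elim)
  open import Data.Fin using (Fin; zero; suc; toℕ)
  open import Data.Fin.Properties using (toℕ-injective; suc-injective; <-cmp)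
  open import Data.List using (List; []; _∷_; length; map; concatMap; allFin; _++_; concat; [_])
  import Data.List as List
  open import Data.List.Membership.Propositional using (_∈_; find)
  open import Data.List.Membership.Propositional.Properties using (∈-map⁺; ∈-map⁻; ∈-++⁺ˡ; ∈-++⁺ʳ; ∈-allFin; ∈-lookup)
  open import Data.List.Properties using (map-tabulate; concatMap-cong; map-concatMap; length-++; length-map; length-tabulate)
  open import Data.List.Relation.Unary.All as All using (All; []; _∷_)
  open import Data.List.Relation.Unary.All.Properties using (++⁺; map⁺)
  import Data.List.Relation.Unary.Any as Any
  open import Data.List.Relation.Unary.Any.Properties using (lookup-index; any⁻)
  open import Data.List.Relation.Unary.AllPairs using ([]; _∷_)
  open import Data.List.Relation.Unary.Unique.Propositional using (Unique)
  import Data.List.Relation.Unary.Unique.Propositional.Properties as Unique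
  open import Data.Nat using (ℕ; zero; suc; _+_; _<_; _<ᵇ_; z≤n; s≤s)
  open import Data.Nat.Combinatorics using (_C_; nC1≡n; nCk+nC[k+1]≡[n+1]C[k+1])
  open import Data.Nat.Properties using (<-irrefl; <-asym; ≡ᵇ⇒≡; ≡⇒≡ᵇ)
  open import Data.Product using (_×_; _,_; proj₁; proj₂)
  open import Data.Sum as Sum using (_⊎_; inj₁; inj₂)
  open import Data.Vec using (lookup)
  open import Function using (_∘_; id)
  open import Function.Bundles using (Equivalence)
  open import Relation.Binary.Definitions using (tri<; tri≈; tri>)
  open import Relation.Binary.PropositionalEquality hiding ([_])
  open import Relation.Nullary using (¬_)
  open ≡-Reasoning

  sucPair : ∀ {n} → Fin n × Fin n → Fin (suc n) × Fin (suc n)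
  sucPair (u , v) = suc u , suc v

  slotList : (n : ℕ) → List (Fin n × Fin n)
  slotList zero = []
  slotList (suc n) = map (λ v → zero , suc v) (allFin n) ++ map sucPair (slotList n)

  slots≡slotList : ∀ n → slots n ≡ slotList n
  slots≡slotList zero = refl
  slots≡slotList (suc n) = begin
    slots (suc n)
      ≡⟨ concatMap-allFin-suc (λ u → concatMap (ifLess u) (allFin (suc n))) ⟩
    concatMap (ifLess zero) (allFin (suc n)) ++ concatMap (λ u → concatMap (ifLess (suc u)) (allFin (suc n))) (allFin n)
      ≡⟨ cong₂ _++_ (trans (concatMap-allFin-suc (ifLess zero)) (concatMap-singleton (λ v → zero , suc v) (allFin n)))
                    (concatMap-cong (λ u → trans (concatMap-allFin-suc (ifLess (suc u)))
                                                 (sym (trans (map-concatMap sucPair (ifLess u) (allFin n))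
                                                             (concatMap-cong (map-ifLess u) (allFin n))))) (allFin n)) ⟩
    map (λ v → zero , suc v) (allFin n) ++ concatMap (λ u → map sucPair (concatMap (ifLess u) (allFin n))) (allFin n)
      ≡⟨ cong (map (λ v → zero , suc v) (allFin n) ++_) (sym (map-concatMap sucPair (λ u → concatMap (ifLess u) (allFin n)) (allFin n))) ⟩
    map (λ v → zero , suc v) (allFin n) ++ map sucPair (slots n)
      ≡⟨ cong (λ l → map (λ v → zero , suc v) (allFin n) ++ map sucPair l) (slots≡slotList n) ⟩
    slotList (suc n) ∎
    where
    ifLess : ∀ {n} → Fin n → Fin n → List (Fin n × Fin n)
    ifLess u v = if toℕ u <ᵇ toℕ v then (u , v) ∷ [] else []
    map-ifLess : ∀ {n} (u v : Fin n) → map sucPair (ifLess u v) ≡ ifLess (suc u) (suc v)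
    map-ifLess u v with toℕ u <ᵇ toℕ v
    ... | true = refl
    ... | false = refl
    concatMap-allFin-suc : ∀ {A : Set} {n} (h : Fin (suc n) → List A) →
      concatMap h (allFin (suc n)) ≡ h zero ++ concatMap (h ∘ suc) (allFin n)
    concatMap-allFin-suc {n = n} h = cong (λ l → h zero ++ concat l) (trans (map-tabulate suc h) (sym (map-tabulate id (h ∘ suc))))
    concatMap-singleton : ∀ {A B : Set} (f : A → B) xs → concatMap (λ x → [ f x ]) xs ≡ map f xs
    concatMap-singleton f [] = refl
    concatMap-singleton f (x ∷ xs) = cong (f x ∷_) (concatMap-singleton f xs)

  S-suc : ∀ n → S (suc n) ≡ n + S n
  S-suc n = begin
    length (slots (suc n))  ≡⟨ cong length (slots≡slotList (suc n)) ⟩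
    length (slotList (suc n)) ≡⟨ length-++ (map (λ v → zero , suc v) (allFin n)) ⟩
    length (map (λ v → zero , suc v) (allFin n)) + length (map sucPair (slotList n))
      ≡⟨ cong₂ _+_ (trans (length-map _ (allFin n)) (length-tabulate id)) (length-map sucPair (slotList n)) ⟩
    n + length (slotList n) ≡⟨ cong (λ l → n + length l) (slots≡slotList n) ⟨
    n + S n ∎

  S≡nC2 : ∀ n → S n ≡ n C 2
  S≡nC2 zero = refl
  S≡nC2 (suc n) = trans (S-suc n) (trans (cong₂ _+_ (sym (nC1≡n n)) (S≡nC2 n)) (nCk+nC[k+1]≡[n+1]C[k+1] n 1))

  Ordered : ∀ {n} → Fin n × Fin n → Set
  Ordered (u , v) = toℕ u < toℕ v

  slots-ordered : ∀ n → All Ordered (slots n)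
  slots-ordered n = subst (All Ordered) (sym (slots≡slotList n)) (slotList-ordered n)
    where
    slotList-ordered : ∀ n → All Ordered (slotList n)
    slotList-ordered zero = []
    slotList-ordered (suc n) = ++⁺ (map⁺ (All.tabulate (λ _ → s≤s z≤n))) (map⁺ (All.map s≤s (slotList-ordered n)))

  ∈-slots : ∀ {n} (u v : Fin n) → toℕ u < toℕ v → (u , v) ∈ slots n
  ∈-slots {n} u v u<v = subst ((u , v) ∈_) (sym (slots≡slotList n)) (∈-slotList u v u<v)
    where
    ∈-slotList : ∀ {n} (u v : Fin n) → toℕ u < toℕ v → (u , v) ∈ slotList n
    ∈-slotList {suc n} zero (suc v) _ = ∈-++⁺ˡ (∈-map⁺ (λ v → zero , suc v) (∈-allFin v))
    ∈-slotList {suc n} (suc u) (suc v) (s≤s u<v) =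
      ∈-++⁺ʳ (map (λ v → zero , suc v) (allFin n)) (∈-map⁺ sucPair (∈-slotList u v u<v))

  slots-unique : ∀ n → Unique (slots n)
  slots-unique n = subst Unique (sym (slots≡slotList n)) (slotList-unique n)
    where
    slotList-unique : ∀ n → Unique (slotList n)
    slotList-unique zero = []
    slotList-unique (suc n) = Unique.++⁺ (Unique.map⁺ zero,suc-injective (Unique.allFin⁺ n))
                                         (Unique.map⁺ sucPair-injective (slotList-unique n)) disjoint
      where
      zero,suc-injective : ∀ {x y : Fin n} → (Fin.zero {n} , suc x) ≡ (zero , suc y) → x ≡ y
      zero,suc-injective refl = refl
      sucPair-injective : ∀ {x y : Fin n × Fin n} → sucPair x ≡ sucPair y → x ≡ y
      sucPair-injective {_ , _} {_ , _} refl = refl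
      disjoint : ∀ {p} → ¬ (p ∈ map (λ v → zero , suc v) (allFin n) × p ∈ map sucPair (slotList n))
      disjoint (p∈₁ , p∈₂) with ∈-map⁻ (λ v → (Fin.zero {n} , suc v)) p∈₁ | ∈-map⁻ sucPair p∈₂
      ... | _ , _ , refl | (_ , _) , _ , ()

  lookup-injective : ∀ {A : Set} {xs : List A} → Unique xs → ∀ i j → List.lookup xs i ≡ List.lookup xs j → i ≡ j
  lookup-injective {xs = x ∷ xs} (_ ∷ u) zero zero eq = refl
  lookup-injective {xs = x ∷ xs} (x∉ ∷ u) zero (suc j) eq = ⊥-elim (All.lookup x∉ (∈-lookup j) eq)
  lookup-injective {xs = x ∷ xs} (x∉ ∷ u) (suc i) zero eq = ⊥-elim (All.lookup x∉ (∈-lookup i) (sym eq))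
  lookup-injective {xs = x ∷ xs} (_ ∷ u) (suc i) (suc j) eq = cong suc (lookup-injective u i j eq)

  slot-ordered : ∀ {n} (k : Fin (S n)) → Ordered (slot {n} k)
  slot-ordered {n} k = All.lookup (slots-ordered n) (∈-lookup k)

  slot-injective : ∀ {n} (k k′ : Fin (S n)) → slot {n} k ≡ slot {n} k′ → k ≡ k′
  slot-injective {n} = lookup-injective (slots-unique n)

  slot-distinct : ∀ {n} (k : Fin (S n)) → proj₁ (slot {n} k) ≢ proj₂ (slot {n} k)
  slot-distinct {n} k eq = <-irrefl (cong toℕ eq) (slot-ordered {n} k)

  slotIndex : ∀ {n} (u v : Fin n) → toℕ u < toℕ v → Fin (S n)
  slotIndex u v u<v = Any.index (∈-slots u v u<v)

  slot-slotIndex : ∀ {n} (u v : Fin n) (u<v : toℕ u < toℕ v) → slot {n} (slotIndex u v u<v) ≡ (u , v)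
  slot-slotIndex u v u<v = sym (lookup-index (∈-slots u v u<v))

  Joins : ∀ {n} → Fin n × Fin n → Fin n → Fin n → Set
  Joins p u v = p ≡ (u , v) ⊎ p ≡ (v , u)

  Joins-sym : ∀ {n} {p : Fin n × Fin n} {u v} → Joins p u v → Joins p v u
  Joins-sym = Sum.swap

  slot-joins-injective : ∀ {n} {k k′ : Fin (S n)} {u v} → Joins (slot {n} k) u v → Joins (slot {n} k′) u v → k ≡ k′
  slot-joins-injective {k = k} {k′} (inj₁ e) (inj₁ e′) = slot-injective k k′ (trans e (sym e′))
  slot-joins-injective {k = k} {k′} (inj₂ e) (inj₂ e′) = slot-injective k k′ (trans e (sym e′))
  slot-joins-injective {n} {k} {k′} (inj₁ e) (inj₂ e′) =
    ⊥-elim (<-asym (subst Ordered e (slot-ordered {n} k)) (subst Ordered e′ (slot-ordered {n} k′)))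
  slot-joins-injective {n} {k} {k′} (inj₂ e) (inj₁ e′) =
    ⊥-elim (<-asym (subst Ordered e (slot-ordered {n} k)) (subst Ordered e′ (slot-ordered {n} k′)))

  ==F⇒≡ : ∀ {n} {a b : Fin n} → T (a ==F b) → a ≡ b
  ==F⇒≡ {a = a} {b} t = toℕ-injective (≡ᵇ⇒≡ (toℕ a) (toℕ b) t)

  ==F-refl : ∀ {n} (a : Fin n) → T (a ==F a)
  ==F-refl a = ≡⇒≡ᵇ (toℕ a) (toℕ a) refl

  -- Definitionally equal to the matching function local to Defs.adj.
  matches : ∀ {n} → Fin n → Fin n → Fin n × Fin n → Bool
  matches u v (a , b) = ((a ==F u) ∧ (b ==F v)) ∨ ((a ==F v) ∧ (b ==F u))

  matches⇒Joins : ∀ {n} (u v : Fin n) p → T (matches u v p) → Joins p u v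
  matches⇒Joins u v (a , b) t = Sum.map pair≡ pair≡ (Equivalence.to T-∨ t)
    where
    pair≡ : ∀ {x y} → T ((a ==F x) ∧ (b ==F y)) → (a , b) ≡ (x , y)
    pair≡ t = let ta , tb = Equivalence.to T-∧ t in cong₂ _,_ (==F⇒≡ ta) (==F⇒≡ tb)

  Joins⇒matches : ∀ {n} {u v : Fin n} p → Joins p u v → T (matches u v p)
  Joins⇒matches {u = u} {v} _ (inj₁ refl) = Equivalence.from T-∨ (inj₁ (Equivalence.from T-∧ (==F-refl u , ==F-refl v)))
  Joins⇒matches {u = u} {v} _ (inj₂ refl) = Equivalence.from T-∨ (inj₂ (Equivalence.from T-∧ (==F-refl v , ==F-refl u)))

  any-allFin-suc : ∀ {n} (f : Fin (suc n) → Bool) → any f (allFin (suc n)) ≡ f zero ∨ any (f ∘ suc) (allFin n)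
  any-allFin-suc {n} f = cong (λ l → f zero ∨ or l) (trans (map-tabulate suc f) (sym (map-tabulate id (f ∘ suc))))

  any-allFin-only : ∀ {n} (f : Fin n → Bool) k₀ → (∀ k → k ≢ k₀ → ¬ T (f k)) → any f (allFin n) ≡ f k₀
  any-allFin-only {suc n} f zero others = trans (any-allFin-suc f)
    (trans (cong (f zero ∨_) (any-allFin-none (f ∘ suc) (λ k → others (suc k) λ ()))) (∨-identityʳ _))
    where
    any-allFin-none : ∀ {n} (f : Fin n → Bool) → (∀ k → ¬ T (f k)) → any f (allFin n) ≡ false
    any-allFin-none {zero} f none = refl
    any-allFin-none {suc n} f none =
      trans (any-allFin-suc f) (cong₂ _∨_ (¬T⇒≡false (none zero)) (any-allFin-none (f ∘ suc) (none ∘ suc)))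
  any-allFin-only {suc n} f (suc k₀) others = trans (any-allFin-suc f)
    (trans (cong (_∨ any (f ∘ suc) (allFin n)) (¬T⇒≡false (others zero λ ())))
           (any-allFin-only (f ∘ suc) k₀ (λ k k≢k₀ → others (suc k) (k≢k₀ ∘ suc-injective))))

  adj-slot : ∀ {n} (G : Graph n) (k : Fin (S n)) {u v} → Joins (slot {n} k) u v → adj G u v ≡ lookup (edgeSet G) k
  adj-slot {n} G k {u} {v} joins = trans (any-allFin-only _ k others)
    (trans (cong (lookup (edgeSet G) k ∧_) (Equivalence.to T-≡ (Joins⇒matches (slot {n} k) joins))) (∧-identityʳ _))
    where
    others : ∀ k′ → k′ ≢ k → ¬ T (lookup (edgeSet G) k′ ∧ matches u v (slot {n} k′))
    others k′ k′≢k t = k′≢k (slot-joins-injective (matches⇒Joins u v (slot {n} k′) (proj₂ (Equivalence.to T-∧ t))) joins)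

  adj-irreflexive : ∀ {n} (G : Graph n) (u : Fin n) → adj G u u ≡ false
  adj-irreflexive {n} G u = ¬T⇒≡false λ t →
    let k , _ , t′ = find (any⁻ _ (allFin (S n)) t) in
    slot-distinct {n} k (loop (matches⇒Joins u u (slot {n} k) (proj₂ (Equivalence.to T-∧ t′))))
    where
    loop : ∀ {p : Fin n × Fin n} → Joins p u u → proj₁ p ≡ proj₂ p
    loop (inj₁ refl) = refl
    loop (inj₂ refl) = refl

  edgeSlot : ∀ {n} (u v : Fin n) → u ≢ v → Fin (S n)
  edgeSlot u v u≢v with <-cmp u v
  ... | tri< u<v _ _ = slotIndex u v u<v
  ... | tri≈ _ u≡v _ = ⊥-elim (u≢v u≡v)
  ... | tri> _ _ v<u = slotIndex v u v<u

  slot-edgeSlot : ∀ {n} (u v : Fin n) (u≢v : u ≢ v) → Joins (slot {n} (edgeSlot u v u≢v)) u v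
  slot-edgeSlot u v u≢v with <-cmp u v
  ... | tri< u<v _ _ = inj₁ (slot-slotIndex u v u<v)
  ... | tri≈ _ u≡v _ = ⊥-elim (u≢v u≡v)
  ... | tri> _ _ v<u = inj₂ (slot-slotIndex v u v<u)

module Isomorphism where

  open Counting
  open Perturbations
  open Slots
  open import Data.Bool using (Bool; true; false; _∨_; not; T)
  open import Data.Bool.ListAction using (all)
  open import Data.Bool.Properties using (T-∧; T-∨; T-≡; T-not-≡)
  open import Data.Empty using (⊥-elim)
  open import Data.Fin using (Fin; zero; suc; punchOut)
  open import Data.Fin.Permutation using (Permutation′; permutation)
  open import Data.Fin.Properties using (_≟_; punchOut-injective; any?; injective⇒≤)
  open import Data.Fin.Subset using (Subset)
  open import Data.List using (List; []; _∷_; map; allFin)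
  open import Data.List.Membership.Propositional using (_∈_; find; lose)
  open import Data.List.Membership.Propositional.Properties using (∈-map⁺; ∈-concat⁺′; ∈-allFin)
  open import Data.List.Relation.Unary.All as All using (All)
  open import Data.List.Relation.Unary.All.Properties using (all⁺; all⁻; tabulate⁺)
  open import Data.List.Relation.Unary.Any using (here)
  open import Data.List.Relation.Unary.Any.Properties using (any⁺; any⁻)
  open import Data.Nat using (ℕ; zero; suc; _*_)
  open import Data.Nat.Properties using (n≮n; +-*-semiring)
  open import Algebra.Properties.Semiring.Sum +-*-semiring using (sum; sum-cong-≗; sum-permute)
  open import Data.Product using (_×_; _,_; proj₁; proj₂; ∃)
  open import Data.Sum using (inj₁; inj₂)
  open import Data.Vec using (Vec; []; _∷_; lookup; tabulate; _[_]≔_)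
  open import Data.Vec.Properties using (lookup∘tabulate; lookup∘update; lookup∘update′)
  open import Function using (_∘_; id)
  open import Function.Bundles using (Equivalence)
  open import Function.Definitions using (Injective)
  open import Relation.Binary.PropositionalEquality hiding ([_])
  open import Relation.Nullary using (yes; no)
  open ≡-Reasoning

  injective⇒surjective : ∀ {n} {f : Fin n → Fin n} → Injective _≡_ _≡_ f → ∀ y → ∃ λ x → f x ≡ y
  injective⇒surjective {suc m} {f} f-injective y with any? (λ x → f x ≟ y)
  ... | yes hit = hit
  ... | no miss = ⊥-elim (n≮n m (injective⇒≤ punchOut∘f-injective))
    where
    y≢f : ∀ x → y ≢ f x
    y≢f x y≡fx = miss (x , sym y≡fx)
    punchOut∘f : Fin (suc m) → Fin m
    punchOut∘f x = punchOut (y≢f x)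
    punchOut∘f-injective : Injective _≡_ _≡_ punchOut∘f
    punchOut∘f-injective {x} {x′} eq = f-injective (punchOut-injective (y≢f x) (y≢f x′) eq)

  module _ {n : ℕ} (f : Fin n → Fin n) (f-injective : Injective _≡_ _≡_ f) where

    inverse : Fin n → Fin n
    inverse y = proj₁ (injective⇒surjective f-injective y)

    inverseʳ : ∀ y → f (inverse y) ≡ y
    inverseʳ y = proj₂ (injective⇒surjective f-injective y)

    inverseˡ : ∀ x → inverse (f x) ≡ x
    inverseˡ x = f-injective (inverseʳ (f x))

    injective⇒permutation : Permutation′ n
    injective⇒permutation = permutation f inverse inverseʳ inverseˡ


  IsIso : ∀ {n} → Vec (Fin n) n → Graph n → Graph n → Set
  IsIso σ G H = Injective _≡_ _≡_ (lookup σ) × (∀ u v → adj G (lookup σ u) (lookup σ v) ≡ adj H u v)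

  all-allFin⁺ : ∀ {n} {p : Fin n → Bool} → T (all p (allFin n)) → ∀ i → T (p i)
  all-allFin⁺ {n} {p} t i = All.lookup (all⁺ p (allFin n) t) (∈-allFin i)

  all-allFin⁻ : ∀ {n} {p : Fin n → Bool} → (∀ i → T (p i)) → T (all p (allFin n))
  all-allFin⁻ {p = p} h = all⁻ p (tabulate⁺ h)

  ==B⇒≡ : ∀ {a b} → T (a ==B b) → a ≡ b
  ==B⇒≡ {true} {true} _ = refl
  ==B⇒≡ {false} {false} _ = refl

  ≡⇒==B : ∀ {a b} → a ≡ b → T (a ==B b)
  ≡⇒==B {true} refl = _
  ≡⇒==B {false} refl = _

  isIso?⇒IsIso : ∀ {n} (σ : Vec (Fin n) n) G H → T (isIso? σ G H) → IsIso σ G H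
  isIso?⇒IsIso {n} σ G H t = σ-injective , λ u v → ==B⇒≡ (all-allFin⁺ (all-allFin⁺ adjacency-holds u) v)
    where
    injectivity-holds : T (injective? σ)
    injectivity-holds = proj₁ (Equivalence.to T-∧ t)
    adjacency-holds : T (all (λ u → all (λ v → adj G (lookup σ u) (lookup σ v) ==B adj H u v) (allFin n)) (allFin n))
    adjacency-holds = proj₂ (Equivalence.to T-∧ t)
    σ-injective : Injective _≡_ _≡_ (lookup σ)
    σ-injective {u} {v} σu≡σv with Equivalence.to T-∨ (all-allFin⁺ (all-allFin⁺ injectivity-holds u) v)
    ... | inj₁ σu≠σv = ⊥-elim (subst (λ b → T (not b)) (Equivalence.to T-≡ σu=σv) σu≠σv)
      where
      σu=σv : T (lookup σ u ==F lookup σ v)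
      σu=σv = subst (λ w → T (w ==F lookup σ v)) (sym σu≡σv) (==F-refl (lookup σ v))
    ... | inj₂ u=v = ==F⇒≡ u=v

  IsIso⇒isIso? : ∀ {n} (σ : Vec (Fin n) n) G H → IsIso σ G H → T (isIso? σ G H)
  IsIso⇒isIso? σ G H (σ-injective , preserves) = Equivalence.from T-∧
    (all-allFin⁻ (λ u → all-allFin⁻ (λ v → injectivity u v)) , all-allFin⁻ (λ u → all-allFin⁻ (λ v → ≡⇒==B (preserves u v))))
    where
    injectivity : ∀ u v → T (not (lookup σ u ==F lookup σ v) ∨ (u ==F v))
    injectivity u v with u ≟ v
    ... | yes refl = Equivalence.from T-∨ (inj₂ (==F-refl u))
    ... | no u≢v = Equivalence.from T-∨ (inj₁ (Equivalence.from T-not-≡ (¬T⇒≡false (u≢v ∘ σ-injective ∘ ==F⇒≡))))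

  ∈-allVecs : ∀ {A : Set} (xs : List A) {k} (v : Vec A k) → (∀ i → lookup v i ∈ xs) → v ∈ allVecs xs k
  ∈-allVecs xs [] _ = here refl
  ∈-allVecs xs (a ∷ w) ∈xs =
    ∈-concat⁺′ (∈-map⁺ (a ∷_) (∈-allVecs xs w (∈xs ∘ suc))) (∈-map⁺ (λ x → map (x ∷_) (allVecs xs _)) (∈xs zero))

  iso?⇒IsIso : ∀ {n} (G H : Graph n) → T (iso? G H) → ∃ λ σ → IsIso σ G H
  iso?⇒IsIso {n} G H t with find (any⁻ (λ σ → isIso? σ G H) (allVecs (allFin n) n) t)
  ... | σ , _ , tσ = σ , isIso?⇒IsIso σ G H tσ

  IsIso⇒iso? : ∀ {n} (G H : Graph n) σ → IsIso σ G H → T (iso? G H)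
  IsIso⇒iso? {n} G H σ iso = any⁺ (λ σ → isIso? σ G H)
    (lose (∈-allVecs (allFin n) σ (λ i → ∈-allFin (lookup σ i))) (IsIso⇒isIso? σ G H iso))

  iso-refl : ∀ {n} (G : Graph n) → T (iso? G G)
  iso-refl {n} G = IsIso⇒iso? G G (tabulate id)
    ( (λ {x} {y} eq → trans (sym (lookup∘tabulate id x)) (trans eq (lookup∘tabulate id y)))
    , λ u v → cong₂ (adj G) (lookup∘tabulate id u) (lookup∘tabulate id v))

  iso-trans : ∀ {n} (G H K : Graph n) → T (iso? G H) → T (iso? H K) → T (iso? G K)
  iso-trans {n} G H K tGH tHK with iso?⇒IsIso G H tGH | iso?⇒IsIso H K tHK
  ... | σ , σ-injective , σ-preserves | τ , τ-injective , τ-preserves = IsIso⇒iso? G K στ (στ-injective , στ-preserves)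
    where
    στ : Vec (Fin n) n
    στ = tabulate (lookup σ ∘ lookup τ)
    lookup-στ : ∀ u → lookup στ u ≡ lookup σ (lookup τ u)
    lookup-στ = lookup∘tabulate (lookup σ ∘ lookup τ)
    στ-injective : Injective _≡_ _≡_ (lookup στ)
    στ-injective {x} {y} eq = τ-injective (σ-injective (trans (sym (lookup-στ x)) (trans eq (lookup-στ y))))
    στ-preserves : ∀ u v → adj G (lookup στ u) (lookup στ v) ≡ adj K u v
    στ-preserves u v rewrite lookup-στ u | lookup-στ v = trans (σ-preserves (lookup τ u) (lookup τ v)) (τ-preserves u v)

  iso-sym : ∀ {n} (G H : Graph n) → T (iso? G H) → T (iso? H G)
  iso-sym {n} G H tGH with iso?⇒IsIso G H tGH
  ... | σ , σ-injective , σ-preserves = IsIso⇒iso? H G σ⁻¹ (σ⁻¹-injective , σ⁻¹-preserves)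
    where
    σ⁻¹ : Vec (Fin n) n
    σ⁻¹ = tabulate (inverse (lookup σ) σ-injective)
    lookup-σ⁻¹ : ∀ u → lookup σ (lookup σ⁻¹ u) ≡ u
    lookup-σ⁻¹ u = trans (cong (lookup σ) (lookup∘tabulate _ u)) (inverseʳ (lookup σ) σ-injective u)
    σ⁻¹-injective : Injective _≡_ _≡_ (lookup σ⁻¹)
    σ⁻¹-injective {x} {y} eq = trans (sym (lookup-σ⁻¹ x)) (trans (cong (lookup σ) eq) (lookup-σ⁻¹ y))
    σ⁻¹-preserves : ∀ u v → adj H (lookup σ⁻¹ u) (lookup σ⁻¹ v) ≡ adj G u v
    σ⁻¹-preserves u v = trans (sym (σ-preserves _ _)) (cong₂ (adj G) (lookup-σ⁻¹ u) (lookup-σ⁻¹ v))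

  Joins-unique : ∀ {n} {p : Fin n × Fin n} {x y x′ y′} → Joins p x y → Joins p x′ y′ → Joins (x′ , y′) x y
  Joins-unique (inj₁ refl) (inj₁ refl) = inj₁ refl
  Joins-unique (inj₁ refl) (inj₂ refl) = inj₂ refl
  Joins-unique (inj₂ refl) (inj₁ refl) = inj₂ refl
  Joins-unique (inj₂ refl) (inj₂ refl) = inj₁ refl

  Joins-injective : ∀ {n} {f : Fin n → Fin n} → Injective _≡_ _≡_ f →
    ∀ {x y x′ y′} → Joins (f x′ , f y′) (f x) (f y) → Joins (x′ , y′) x y
  Joins-injective f-injective (inj₁ eq) = inj₁ (cong₂ _,_ (f-injective (cong proj₁ eq)) (f-injective (cong proj₂ eq)))
  Joins-injective f-injective (inj₂ eq) = inj₂ (cong₂ _,_ (f-injective (cong proj₁ eq)) (f-injective (cong proj₂ eq)))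

  module SlotPermutation {n} (σ : Vec (Fin n) n) (σ-injective : Injective _≡_ _≡_ (lookup σ)) where

    π : Fin (S n) → Fin (S n)
    π k = edgeSlot (lookup σ (proj₁ (slot {n} k))) (lookup σ (proj₂ (slot {n} k))) (slot-distinct {n} k ∘ σ-injective)

    slot-π : ∀ k {u v} → Joins (slot {n} k) u v → Joins (slot {n} (π k)) (lookup σ u) (lookup σ v)
    slot-π k (inj₁ refl) = slot-edgeSlot _ _ _
    slot-π k (inj₂ refl) = Joins-sym (slot-edgeSlot _ _ _)

    π-injective : Injective _≡_ _≡_ π
    π-injective {k} {k′} πk≡πk′ = slot-joins-injective {n} {k} {k′} (inj₁ refl)
      (Joins-injective σ-injective (Joins-unique (slot-π k (inj₁ refl))
        (subst (λ j → Joins (slot {n} j) _ _) (sym πk≡πk′) (slot-π k′ (inj₁ refl)))))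

    -- mkGraph at this n, which Agda cannot infer from an argument of type Subset (S n).
    graph : Subset (S n) → Graph n
    graph = mkGraph

    permute : Subset (S n) → Subset (S n)
    permute V = tabulate (lookup V ∘ π)

    adj-permute : ∀ V u v → adj (graph (permute V)) u v ≡ adj (graph V) (lookup σ u) (lookup σ v)
    adj-permute V u v with u ≟ v
    ... | yes refl = trans (adj-irreflexive (graph (permute V)) u) (sym (adj-irreflexive (graph V) (lookup σ u)))
    ... | no u≢v = begin
      adj (graph (permute V)) u v             ≡⟨ adj-slot (graph (permute V)) k (slot-edgeSlot u v u≢v) ⟩
      lookup (permute V) k                    ≡⟨ lookup∘tabulate (lookup V ∘ π) k ⟩
      lookup V (π k)                          ≡⟨ adj-slot (graph V) (π k) (slot-π k (slot-edgeSlot u v u≢v)) ⟨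
      adj (graph V) (lookup σ u) (lookup σ v) ∎
      where
      k : Fin (S n)
      k = edgeSlot u v u≢v

    iso?-permute : ∀ (F : Graph n) V → iso? (graph (permute V)) F ≡ iso? (graph V) F
    iso?-permute F V = T-ext (iso-trans (graph V) (graph (permute V)) F V≅πV)
                             (iso-trans (graph (permute V)) (graph V) F (iso-sym (graph V) (graph (permute V)) V≅πV))
      where
      V≅πV : T (iso? (graph V) (graph (permute V)))
      V≅πV = IsIso⇒iso? (graph V) (graph (permute V)) σ (σ-injective , λ u v → sym (adj-permute V u v))

    edges-permute : ∀ (A B : Graph n) → IsIso σ A B → ∀ k → lookup (edgeSet B) k ≡ lookup (edgeSet A) (π k)
    edges-permute A B (_ , preserves) k = begin
      lookup (edgeSet B) k                             ≡⟨ adj-slot B k (inj₁ refl) ⟨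
      adj B (proj₁ (slot {n} k)) (proj₂ (slot {n} k))  ≡⟨ preserves _ _ ⟨
      adj A (lookup σ (proj₁ (slot {n} k))) (lookup σ (proj₂ (slot {n} k))) ≡⟨ adj-slot A (π k) (slot-π k (inj₁ refl)) ⟩
      lookup (edgeSet A) (π k)                         ∎

    swap-permute : ∀ {W V : Subset (S n)} → (∀ k → lookup W k ≡ lookup V (π k)) → ∀ e f →
      swap W e f ≡ permute (swap V (π e) (π f))
    swap-permute {W} {V} W≗Vπ e f = Vec-ext pointwise
      where
      pointwise : ∀ k → lookup (swap W e f) k ≡ lookup (permute (swap V (π e) (π f))) k
      pointwise k rewrite lookup∘tabulate (lookup (swap V (π e) (π f)) ∘ π) k with k ≟ f
      ... | yes refl = trans (lookup∘update k (W [ e ]≔ false) true) (sym (lookup∘update (π k) (V [ π e ]≔ false) true))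
      ... | no k≢f with k ≟ e
      ... | yes refl = trans (lookup∘update′ k≢f (W [ e ]≔ false) true) (trans (lookup∘update k W false)
            (sym (trans (lookup∘update′ (k≢f ∘ π-injective) (V [ π e ]≔ false) true) (lookup∘update (π k) V false))))
      ... | no k≢e = trans (lookup∘update′ k≢f (W [ e ]≔ false) true) (trans (lookup∘update′ k≢e W false) (trans (W≗Vπ k)
            (sym (trans (lookup∘update′ (k≢f ∘ π-injective) (V [ π e ]≔ false) true) (lookup∘update′ (k≢e ∘ π-injective) V false)))))

  deckCount-one : ∀ {n} (F G : Graph n) →
    deckCount 1 F G ≡ sum (λ e → sum (λ f → ⟦ lookup (edgeSet G) e ⟧ * (⟦ not (lookup (edgeSet G) f) ⟧ *
                                             ⟦ iso? (mkGraph (swap (edgeSet G) e f)) F ⟧)))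
  deckCount-one F G = trans (deckCount≡sumSubsets 1 F G) (sumSubsets-oneSwap (edgeSet G) (λ Z → ⟦ iso? (mkGraph Z) F ⟧))

  deckCount-one-iso-invariant : ∀ {n} (F A B : Graph n) → T (iso? A B) → deckCount 1 F B ≡ deckCount 1 F A
  deckCount-one-iso-invariant {n} F A B A≅B = begin
    deckCount 1 F B
      ≡⟨ deckCount-one F B ⟩
    sum (λ e → sum (λ f → ⟦ lookup EB e ⟧ * (⟦ not (lookup EB f) ⟧ * ⟦ iso? (graph (swap EB e f)) F ⟧)))
      ≡⟨ sum-cong-≗ (λ e → sum-cong-≗ (λ f → transport e f)) ⟩
    sum (λ e → sum (λ f → g (π e) (π f)))
      ≡⟨ sum-cong-≗ (λ e → sum-permute (g (π e)) P) ⟨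
    sum (λ e → sum (g (π e)))
      ≡⟨ sum-permute (λ e → sum (g e)) P ⟨
    sum (λ e → sum (g e))
      ≡⟨ deckCount-one F A ⟨
    deckCount 1 F A ∎
    where
    σ : Vec (Fin n) n
    σ = proj₁ (iso?⇒IsIso A B A≅B)
    A≅ₛB : IsIso σ A B
    A≅ₛB = proj₂ (iso?⇒IsIso A B A≅B)
    open SlotPermutation σ (proj₁ A≅ₛB)
    EA EB : Subset (S n)
    EA = edgeSet A
    EB = edgeSet B
    g : Fin (S n) → Fin (S n) → ℕ
    g e f = ⟦ lookup EA e ⟧ * (⟦ not (lookup EA f) ⟧ * ⟦ iso? (graph (swap EA e f)) F ⟧)
    P : Permutation′ (S n)
    P = injective⇒permutation π π-injective
    transport : ∀ e f → ⟦ lookup EB e ⟧ * (⟦ not (lookup EB f) ⟧ * ⟦ iso? (graph (swap EB e f)) F ⟧) ≡ g (π e) (π f)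
    transport e f = cong₂ (λ x y → x * y) (cong ⟦_⟧ (edges-permute A B A≅ₛB e))
      (cong₂ (λ x y → x * y) (cong (⟦_⟧ ∘ not) (edges-permute A B A≅ₛB f))
        (trans (cong (λ Z → ⟦ iso? (graph Z) F ⟧) (swap-permute {EB} {EA} (edges-permute A B A≅ₛB) e f))
               (cong ⟦_⟧ (iso?-permute F (swap EA (π e) (π f))))))

module IsomorphismClasses where

  open Counting
  open Isomorphism
  open import Data.Bool using (true; false; T)
  open import Data.Bool.ListAction using (any)
  open import Data.Bool.Properties using (T-≡)
  open import Data.Fin.Subset using (Subset; ∣_∣)
  open import Data.List using (List; []; _∷_; map; reverse; [_])
  open import Data.List.Membership.Propositional using (_∈_; find; lose)
  open import Data.List.Membership.Propositional.Properties using (∈-map⁺; ∈-filter⁺)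
  open import Data.List.Properties using (unfold-reverse)
  open import Data.List.Relation.Unary.All as All using (All; []; _∷_)
  open import Data.List.Relation.Unary.All.Properties using (all-filter; ++⁺)
  open import Data.List.Relation.Unary.Any using (here; there)
  open import Data.List.Relation.Unary.Any.Properties using (any⁺; any⁻)
  open import Data.Nat using (ℕ; suc; _*_; _≤_; _≡ᵇ_; z≤n)
  open import Data.Nat.Properties using (≤-trans; ≤-antisym; ≤-reflexive; m≤n+m; ≡ᵇ⇒≡; ≡⇒≡ᵇ)
  open import Data.Product using (_,_)
  open import Data.Sum using (_⊎_; inj₁; inj₂)
  open import Data.Vec using (lookup)
  open import Function using (_∘_)
  open import Function.Bundles using (Equivalence)
  open import Relation.Binary.PropositionalEquality hiding ([_])
  open import Relation.Nullary using (¬_)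
  open import Relation.Nullary.Decidable using (T?)

  private
    variable
      A : Set

  All-reverse : ∀ {P : A → Set} {xs} → All P xs → All P (reverse xs)
  All-reverse [] = []
  All-reverse {P = P} {x ∷ xs} (px ∷ pxs) = subst (All P) (sym (unfold-reverse x xs)) (++⁺ (All-reverse pxs) (px ∷ []))

  module _ {n : ℕ} where

    multiplicity : Graph n → List (Graph n) → ℕ
    multiplicity X = sumMap (λ G → ⟦ iso? X G ⟧)

    repsFrom-atMostOnce : ∀ acc Gs → (∀ X → multiplicity X acc ≤ 1) → ∀ X → multiplicity X (repsFrom acc Gs) ≤ 1
    repsFrom-atMostOnce acc [] atMost X = subst (_≤ 1) (sym (sumMap-reverse _ acc)) (atMost X)
    repsFrom-atMostOnce acc (G ∷ Gs) atMost with any (λ H → iso? H G) acc in seen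
    ... | true = repsFrom-atMostOnce acc Gs atMost
    ... | false = repsFrom-atMostOnce (G ∷ acc) Gs atMost′
      where
      atMost′ : ∀ X → multiplicity X (G ∷ acc) ≤ 1
      atMost′ X with iso? X G in X≅G
      ... | false = atMost X
      ... | true = ≤-reflexive (cong suc (sumMap-none (iso? X) acc unseen))
        where
        unseen : ∀ {H} → H ∈ acc → ¬ T (iso? X H)
        unseen {H} H∈acc X≅H = subst T seen
          (any⁺ (λ H → iso? H G) (lose H∈acc (iso-trans H X G (iso-sym X H X≅H) (Equivalence.from T-≡ X≅G))))

    repsFrom-atLeastOnce : ∀ acc Gs X → X ∈ Gs ⊎ 1 ≤ multiplicity X acc → 1 ≤ multiplicity X (repsFrom acc Gs)
    repsFrom-atLeastOnce acc [] X (inj₂ found) = subst (1 ≤_) (sym (sumMap-reverse _ acc)) found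
    repsFrom-atLeastOnce acc (G ∷ Gs) X found with any (λ H → iso? H G) acc in seen
    ... | true = repsFrom-atLeastOnce acc Gs X (skip found)
      where
      skip : X ∈ G ∷ Gs ⊎ 1 ≤ multiplicity X acc → X ∈ Gs ⊎ 1 ≤ multiplicity X acc
      skip (inj₁ (here refl)) with find (any⁻ (λ H → iso? H G) acc (Equivalence.from T-≡ seen))
      ... | H , H∈acc , H≅G = inj₂ (sumMap-some (iso? X) H∈acc (iso-sym H G H≅G))
      skip (inj₁ (there X∈Gs)) = inj₁ X∈Gs
      skip (inj₂ found) = inj₂ found
    ... | false = repsFrom-atLeastOnce (G ∷ acc) Gs X (keep found)
      where
      keep : X ∈ G ∷ Gs ⊎ 1 ≤ multiplicity X acc → X ∈ Gs ⊎ 1 ≤ multiplicity X (G ∷ acc)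
      keep (inj₁ (here refl)) = inj₂ (sumMap-some (iso? X) {G ∷ acc} (here refl) (iso-refl X))
      keep (inj₁ (there X∈Gs)) = inj₁ X∈Gs
      keep (inj₂ found) = inj₂ (≤-trans found (m≤n+m _ ⟦ iso? X G ⟧))

    repsFrom-All : ∀ {P : Graph n → Set} acc Gs → All P acc → All P Gs → All P (repsFrom acc Gs)
    repsFrom-All acc [] Pacc _ = All-reverse Pacc
    repsFrom-All acc (G ∷ Gs) Pacc (PG ∷ PGs) with any (λ H → iso? H G) acc
    ... | true = repsFrom-All acc Gs Pacc PGs
    ... | false = repsFrom-All (G ∷ acc) Gs (PG ∷ Pacc) PGs


  classes-edges : ∀ n m → All (λ G → edges G ≡ m) (classes n m)
  classes-edges n m = repsFrom-All [] (graphsWith n m) []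
    (All.map (λ {G} → ≡ᵇ⇒≡ (edges G) m) (all-filter (T? ∘ (λ G → edges G ≡ᵇ m)) (map mkGraph (allSubsets (S n)))))

  multiplicity-classes : ∀ n m (H : Subset (S n)) → ∣ H ∣ ≡ m → multiplicity (mkGraph H) (classes n m) ≡ 1
  multiplicity-classes n m H ∣H∣≡m = ≤-antisym
    (repsFrom-atMostOnce [] (graphsWith n m) (λ _ → z≤n) (mkGraph H))
    (repsFrom-atLeastOnce [] (graphsWith n m) (mkGraph H) (inj₁ H∈graphsWith))
    where
    H∈graphsWith : mkGraph H ∈ graphsWith n m
    H∈graphsWith = ∈-filter⁺ (T? ∘ (λ G → edges G ≡ᵇ m))
      (∈-map⁺ mkGraph (∈-allVecs (true ∷ false ∷ []) H (λ i → Bool∈ (lookup H i)))) (≡⇒≡ᵇ ∣ H ∣ m ∣H∣≡m)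
      where
      Bool∈ : ∀ b → b ∈ true ∷ false ∷ []
      Bool∈ true = here refl
      Bool∈ false = there (here refl)

  sumMap-classes : ∀ n m (H : Subset (S n)) → ∣ H ∣ ≡ m → (w : Graph n → ℕ) → (∀ A B → T (iso? A B) → w B ≡ w A) →
    sumMap (λ G → ⟦ iso? (mkGraph H) G ⟧ * w G) (classes n m) ≡ w (mkGraph H)
  sumMap-classes n m H ∣H∣≡m w w-invariant =
    sumMap-unique (iso? (mkGraph H)) w (classes n m) (multiplicity-classes n m H ∣H∣≡m) (λ {G} _ → w-invariant (mkGraph H) G)

module Recurrence where

  open Counting
  open Perturbations
  open Slots
  open Isomorphism
  open IsomorphismClasses
  open import Data.Bool using (Bool; true; false)
  open import Data.Empty using (⊥-elim)
  open import Data.Fin using (Fin)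
  open import Data.Fin.Subset using (Subset; ∁; _∩_; ∣_∣)
  open import Data.Fin.Subset.Properties using (∩-comm)
  open import Data.Integer using (ℤ; +_; _-_) renaming (_+_ to _+ℤ_; _*_ to _*ℤ_)
  import Data.Integer.Properties as ℤ
  import Data.Integer.Tactic.RingSolver as ℤ-Solver
  open import Data.List using (List; []; _∷_; map; allFin; foldr)
  open import Data.Vec using ([]; _∷_)
  open import Data.List.Membership.Propositional.Properties using (∈-lookup)
  open import Data.List.Relation.Unary.All as All using (All)
  open import Data.Nat using (ℕ; zero; suc; _+_; _*_; _^_)
  open import Data.Nat.Combinatorics using (_C_)
  open import Data.Nat.Properties using (+-assoc; *-identityʳ; *-zeroʳ; +-identityʳ; 1+n≢n; m≢1+n+m)
  open import Data.Nat.Tactic.RingSolver using (solve-∀)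
  open import Data.Product using (_,_; proj₁)
  open import Function using (_∘_)
  open import Relation.Binary.PropositionalEquality hiding ([_])
  open ≡-Reasoning

  private
    variable
      k : ℕ

  lowerCoefficient : ℕ → ℕ → ℕ → ℤ
  lowerCoefficient m s i = ((+ m - + i) +ℤ + 1) *ℤ ((+ s - + m - + i) +ℤ + 1)

  middleCoefficient : ℕ → ℕ → ℤ
  middleCoefficient s i = + i *ℤ (+ s - + 2 *ℤ + i)

  upperCoefficient : ℕ → ℤ
  upperCoefficient i = + (suc i ^ 2)

  pos-twoStepCount : ∀ i p q r t → + twoStepCount i p q r t ≡
    + ⟦ both≡ᵇ i q r ⟧ *ℤ (+ p *ℤ + q) +ℤ (+ ⟦ both≡ᵇ i (suc q) (suc r) ⟧ *ℤ (+ p *ℤ + t) +ℤ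
    (+ ⟦ both≡ᵇ (suc i) q r ⟧ *ℤ (+ r *ℤ + q) +ℤ + ⟦ both≡ᵇ i q r ⟧ *ℤ (+ r *ℤ + t)))
  pos-twoStepCount i p q r t =
    cong₂ _+ℤ_ (pos-*₃ ⟦ both≡ᵇ i q r ⟧ p q) (cong₂ _+ℤ_ (pos-*₃ ⟦ both≡ᵇ i (suc q) (suc r) ⟧ p t)
               (cong₂ _+ℤ_ (pos-*₃ ⟦ both≡ᵇ (suc i) q r ⟧ r q) (pos-*₃ ⟦ both≡ᵇ i q r ⟧ r t)))
    where
    pos-*₃ : ∀ a b c → + (a * (b * c)) ≡ + a *ℤ (+ b *ℤ + c)
    pos-*₃ a b c = trans (ℤ.pos-* a (b * c)) (cong (+ a *ℤ_) (ℤ.pos-* b c))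

  upperCoefficient-square : ∀ i → upperCoefficient i ≡ + suc i *ℤ + suc i
  upperCoefficient-square i = trans (cong (λ x → + (suc i * x)) (*-identityʳ (suc i))) (ℤ.pos-* (suc i) (suc i))

  twoStepCount-coefficients : ∀ j {m s} p q r t → m ≡ p + q → s ≡ p + q + r + t →
    + twoStepCount (suc j) p q r t ≡
    lowerCoefficient m s (suc j) *ℤ + ⟦ both≡ᵇ j q r ⟧ +ℤ
    (middleCoefficient s (suc j) *ℤ + ⟦ both≡ᵇ (suc j) q r ⟧ +ℤ upperCoefficient (suc j) *ℤ + ⟦ both≡ᵇ (suc (suc j)) q r ⟧)
  twoStepCount-coefficients j p q r t refl refl =
    trans (pos-twoStepCount (suc j) p q r t) (byCell _ _ _ refl refl refl)
    where
    L M U : ℤ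
    L = lowerCoefficient (p + q) (p + q + r + t) (suc j)
    M = middleCoefficient (p + q + r + t) (suc j)
    U = upperCoefficient (suc j)
    removed : ∀ a → both≡ᵇ a q r ≡ true → q ≡ a
    removed a = proj₁ ∘ both≡ᵇ⇒≡ a q r
    lowerCell : ∀ P J T B C →
      + 0 *ℤ (P *ℤ J) +ℤ (+ 1 *ℤ (P *ℤ T) +ℤ (+ 0 *ℤ (J *ℤ J) +ℤ + 0 *ℤ (J *ℤ T))) ≡
      ((P +ℤ J - (+ 1 +ℤ J)) +ℤ + 1) *ℤ ((P +ℤ J +ℤ J +ℤ T - (P +ℤ J) - (+ 1 +ℤ J)) +ℤ + 1) *ℤ + 1
        +ℤ (B *ℤ + 0 +ℤ C *ℤ + 0)
    lowerCell = ℤ-Solver.solve-∀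
    middleCell : ∀ P J T A C →
      + 1 *ℤ (P *ℤ (+ 1 +ℤ J)) +ℤ (+ 0 *ℤ (P *ℤ T) +ℤ (+ 0 *ℤ ((+ 1 +ℤ J) *ℤ (+ 1 +ℤ J)) +ℤ + 1 *ℤ ((+ 1 +ℤ J) *ℤ T))) ≡
      A *ℤ + 0 +ℤ ((+ 1 +ℤ J) *ℤ (P +ℤ (+ 1 +ℤ J) +ℤ (+ 1 +ℤ J) +ℤ T - + 2 *ℤ (+ 1 +ℤ J)) *ℤ + 1 +ℤ C *ℤ + 0)
    middleCell = ℤ-Solver.solve-∀
    upperCell : ∀ P J T A B →
      + 0 *ℤ (P *ℤ (+ 2 +ℤ J)) +ℤ (+ 0 *ℤ (P *ℤ T) +ℤ (+ 1 *ℤ ((+ 2 +ℤ J) *ℤ (+ 2 +ℤ J)) +ℤ + 0 *ℤ ((+ 2 +ℤ J) *ℤ T))) ≡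
      A *ℤ + 0 +ℤ (B *ℤ + 0 +ℤ (+ 2 +ℤ J) *ℤ (+ 2 +ℤ J) *ℤ + 1)
    upperCell = ℤ-Solver.solve-∀
    noCell : ∀ X₁ X₂ X₃ X₄ A B C →
      + 0 *ℤ X₁ +ℤ (+ 0 *ℤ X₂ +ℤ (+ 0 *ℤ X₃ +ℤ + 0 *ℤ X₄)) ≡ A *ℤ + 0 +ℤ (B *ℤ + 0 +ℤ C *ℤ + 0)
    noCell = ℤ-Solver.solve-∀
    byCell : ∀ x y w → both≡ᵇ j q r ≡ x → both≡ᵇ (suc j) q r ≡ y → both≡ᵇ (suc (suc j)) q r ≡ w →
      + ⟦ y ⟧ *ℤ (+ p *ℤ + q) +ℤ (+ ⟦ x ⟧ *ℤ (+ p *ℤ + t) +ℤ (+ ⟦ w ⟧ *ℤ (+ r *ℤ + q) +ℤ + ⟦ y ⟧ *ℤ (+ r *ℤ + t))) ≡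
      L *ℤ + ⟦ x ⟧ +ℤ (M *ℤ + ⟦ y ⟧ +ℤ U *ℤ + ⟦ w ⟧)
    byCell true true _ ex ey _ = ⊥-elim (1+n≢n (trans (sym (removed (suc j) ey)) (removed j ex)))
    byCell true false true ex _ ew = ⊥-elim (m≢1+n+m j (trans (sym (removed j ex)) (removed (suc (suc j)) ew)))
    byCell false true true _ ey ew = ⊥-elim (1+n≢n (trans (sym (removed (suc (suc j)) ew)) (removed (suc j) ey)))
    byCell true false false ex _ _ with both≡ᵇ⇒≡ j q r ex
    ... | refl , refl = lowerCell (+ p) (+ j) (+ t) M U
    byCell false true false _ ey _ with both≡ᵇ⇒≡ (suc j) q r ey
    ... | refl , refl = middleCell (+ p) (+ j) (+ t) L U
    byCell false false true _ _ ew with both≡ᵇ⇒≡ (suc (suc j)) q r ew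
    ... | refl , refl = trans (upperCell (+ p) (+ j) (+ t) L M)
                              (cong (λ c → L *ℤ + 0 +ℤ (M *ℤ + 0 +ℤ c *ℤ + 1)) (sym (upperCoefficient-square (suc j))))
    byCell false false false _ _ _ = noCell (+ p *ℤ + q) (+ p *ℤ + t) (+ r *ℤ + q) (+ r *ℤ + t) L M U

  sumSubsets-linearℤ : (f g₁ g₂ g₃ : Subset k → ℕ) (a b c : ℤ) →
    (∀ Z → + f Z ≡ a *ℤ + g₁ Z +ℤ (b *ℤ + g₂ Z +ℤ c *ℤ + g₃ Z)) →
    + sumSubsets f ≡ a *ℤ + sumSubsets g₁ +ℤ (b *ℤ + sumSubsets g₂ +ℤ c *ℤ + sumSubsets g₃)
  sumSubsets-linearℤ {zero} f g₁ g₂ g₃ a b c pointwise = pointwise []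
  sumSubsets-linearℤ {suc k} f g₁ g₂ g₃ a b c pointwise = trans
    (cong₂ _+ℤ_ (half (true ∷_)) (half (false ∷_)))
    (regroup a b c (+ sumSubsets (g₁ ∘ (true ∷_))) (+ sumSubsets (g₂ ∘ (true ∷_))) (+ sumSubsets (g₃ ∘ (true ∷_)))
                   (+ sumSubsets (g₁ ∘ (false ∷_))) (+ sumSubsets (g₂ ∘ (false ∷_))) (+ sumSubsets (g₃ ∘ (false ∷_))))
    where
    half : (extend : Subset k → Subset (suc k)) →
      + sumSubsets (f ∘ extend) ≡ a *ℤ + sumSubsets (g₁ ∘ extend) +ℤ (b *ℤ + sumSubsets (g₂ ∘ extend) +ℤ c *ℤ + sumSubsets (g₃ ∘ extend))
    half extend = sumSubsets-linearℤ (f ∘ extend) (g₁ ∘ extend) (g₂ ∘ extend) (g₃ ∘ extend) a b c (pointwise ∘ extend)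
    regroup : ∀ a b c x₁ y₁ w₁ x₂ y₂ w₂ →
      (a *ℤ x₁ +ℤ (b *ℤ y₁ +ℤ c *ℤ w₁)) +ℤ (a *ℤ x₂ +ℤ (b *ℤ y₂ +ℤ c *ℤ w₂)) ≡
      a *ℤ (x₁ +ℤ x₂) +ℤ (b *ℤ (y₁ +ℤ y₂) +ℤ c *ℤ (w₁ +ℤ w₂))
    regroup = ℤ-Solver.solve-∀

  indicator-scale : ∀ (ι : Bool) N x y w (a b c : ℤ) → + N ≡ a *ℤ + x +ℤ (b *ℤ + y +ℤ c *ℤ + w) →
    + (⟦ ι ⟧ * N) ≡ a *ℤ + (x * ⟦ ι ⟧) +ℤ (b *ℤ + (y * ⟦ ι ⟧) +ℤ c *ℤ + (w * ⟦ ι ⟧))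
  indicator-scale true N x y w a b c eq rewrite +-identityʳ N | *-identityʳ x | *-identityʳ y | *-identityʳ w = eq
  indicator-scale false N x y w a b c _
    rewrite *-zeroʳ x | *-zeroʳ y | *-zeroʳ w | ℤ.*-zeroʳ a | ℤ.*-zeroʳ b | ℤ.*-zeroʳ c = refl

  foldr-pos : ∀ {A : Set} (f g : A → ℕ) (xs : List A) →
    foldr _+ℤ_ (+ 0) (map (λ x → + f x *ℤ + g x) xs) ≡ + sumMap (λ x → f x * g x) xs
  foldr-pos f g [] = refl
  foldr-pos f g (x ∷ xs) = cong₂ _+ℤ_ (sym (ℤ.pos-* (f x) (g x))) (foldr-pos f g xs)

  module DeckProduct (n m j : ℕ) (k l : Fin (classCount n m)) where

    private
      i : ℕ
      i = suc j
      F G : Graph n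
      F = rep {n} {m} k
      G = rep {n} {m} l
      E : Subset (S n)
      E = edgeSet G

    ∣E∣≡m : ∣ E ∣ ≡ m
    ∣E∣≡m = All.lookup (classes-edges n m) (∈-lookup l)

    twoStep : Subset (S n) → ℕ
    twoStep Z = sumSubsets (λ H → ⟦ E ⇝[ i ] H ⟧ * ⟦ H ⇝[ 1 ] Z ⟧)

    classes-deckCount-one : ∀ H →
      sumMap (λ G′ → deckCount 1 F G′ * (⟦ E ⇝[ i ] H ⟧ * ⟦ iso? (mkGraph H) G′ ⟧)) (classes n m) ≡
      ⟦ E ⇝[ i ] H ⟧ * sumSubsets (λ Z → ⟦ H ⇝[ 1 ] Z ⟧ * ⟦ iso? (mkGraph Z) F ⟧)
    classes-deckCount-one H = begin
      sumMap (λ G′ → deckCount 1 F G′ * (⟦ E ⇝[ i ] H ⟧ * ⟦ iso? (mkGraph H) G′ ⟧)) (classes n m)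
        ≡⟨ sumMap-cong (λ G′ → *-cycle (deckCount 1 F G′) ⟦ E ⇝[ i ] H ⟧ ⟦ iso? (mkGraph H) G′ ⟧) (classes n m) ⟩
      sumMap (λ G′ → ⟦ E ⇝[ i ] H ⟧ * (⟦ iso? (mkGraph H) G′ ⟧ * deckCount 1 F G′)) (classes n m)
        ≡⟨ sumMap-*ˡ ⟦ E ⇝[ i ] H ⟧ (λ G′ → ⟦ iso? (mkGraph H) G′ ⟧ * deckCount 1 F G′) (classes n m) ⟩
      ⟦ E ⇝[ i ] H ⟧ * sumMap (λ G′ → ⟦ iso? (mkGraph H) G′ ⟧ * deckCount 1 F G′) (classes n m)
        ≡⟨ onPerturbations ⟩
      ⟦ E ⇝[ i ] H ⟧ * deckCount 1 F (mkGraph H)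
        ≡⟨ cong (⟦ E ⇝[ i ] H ⟧ *_) (deckCount≡sumSubsets 1 F (mkGraph H)) ⟩
      ⟦ E ⇝[ i ] H ⟧ * sumSubsets (λ Z → ⟦ H ⇝[ 1 ] Z ⟧ * ⟦ iso? (mkGraph Z) F ⟧) ∎
      where
      *-cycle : ∀ x y z → x * (y * z) ≡ y * (z * x)
      *-cycle = solve-∀
      onPerturbations : ⟦ E ⇝[ i ] H ⟧ * sumMap (λ G′ → ⟦ iso? (mkGraph H) G′ ⟧ * deckCount 1 F G′) (classes n m) ≡
                        ⟦ E ⇝[ i ] H ⟧ * deckCount 1 F (mkGraph H)
      onPerturbations with E ⇝[ i ] H in E⇝H
      ... | false = refl
      ... | true = cong (1 *_) (sumMap-classes n m H (trans (⇝-preserves-∣∣ E H i E⇝H) ∣E∣≡m) (deckCount 1 F)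
                                               (deckCount-one-iso-invariant F))

    product≡sumSubsets : sumMap (λ G′ → deckCount 1 F G′ * deckCount i G′ G) (classes n m) ≡
                         sumSubsets (λ Z → ⟦ iso? (mkGraph Z) F ⟧ * twoStep Z)
    product≡sumSubsets = begin
      sumMap (λ G′ → deckCount 1 F G′ * deckCount i G′ G) (classes n m)
        ≡⟨ sumMap-cong (λ G′ → trans (cong (deckCount 1 F G′ *_) (deckCount≡sumSubsets i G′ G))
                                     (sym (sumSubsets-*ˡ (deckCount 1 F G′) (λ H → ⟦ E ⇝[ i ] H ⟧ * ⟦ iso? (mkGraph H) G′ ⟧))))
                       (classes n m) ⟩
      sumMap (λ G′ → sumSubsets (λ H → deckCount 1 F G′ * (⟦ E ⇝[ i ] H ⟧ * ⟦ iso? (mkGraph H) G′ ⟧))) (classes n m)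
        ≡⟨ sumMap-sumSubsets (λ G′ H → deckCount 1 F G′ * (⟦ E ⇝[ i ] H ⟧ * ⟦ iso? (mkGraph H) G′ ⟧)) (classes n m) ⟩
      sumSubsets (λ H → sumMap (λ G′ → deckCount 1 F G′ * (⟦ E ⇝[ i ] H ⟧ * ⟦ iso? (mkGraph H) G′ ⟧)) (classes n m))
        ≡⟨ sumSubsets-cong classes-deckCount-one ⟩
      sumSubsets (λ H → ⟦ E ⇝[ i ] H ⟧ * sumSubsets (λ Z → ⟦ H ⇝[ 1 ] Z ⟧ * ⟦ iso? (mkGraph Z) F ⟧))
        ≡⟨ sumSubsets-cong (λ H → sym (sumSubsets-*ˡ ⟦ E ⇝[ i ] H ⟧ (λ Z → ⟦ H ⇝[ 1 ] Z ⟧ * ⟦ iso? (mkGraph Z) F ⟧))) ⟩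
      sumSubsets (λ H → sumSubsets (λ Z → ⟦ E ⇝[ i ] H ⟧ * (⟦ H ⇝[ 1 ] Z ⟧ * ⟦ iso? (mkGraph Z) F ⟧)))
        ≡⟨ sumSubsets-comm (λ H Z → ⟦ E ⇝[ i ] H ⟧ * (⟦ H ⇝[ 1 ] Z ⟧ * ⟦ iso? (mkGraph Z) F ⟧)) ⟩
      sumSubsets (λ Z → sumSubsets (λ H → ⟦ E ⇝[ i ] H ⟧ * (⟦ H ⇝[ 1 ] Z ⟧ * ⟦ iso? (mkGraph Z) F ⟧)))
        ≡⟨ sumSubsets-cong (λ Z → trans (sumSubsets-cong (λ H → *-rotate ⟦ E ⇝[ i ] H ⟧ ⟦ H ⇝[ 1 ] Z ⟧ ⟦ iso? (mkGraph Z) F ⟧))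
                                        (sumSubsets-*ˡ ⟦ iso? (mkGraph Z) F ⟧ (λ H → ⟦ E ⇝[ i ] H ⟧ * ⟦ H ⇝[ 1 ] Z ⟧))) ⟩
      sumSubsets (λ Z → ⟦ iso? (mkGraph Z) F ⟧ * twoStep Z) ∎
      where
      *-rotate : ∀ x y z → x * (y * z) ≡ z * (x * y)
      *-rotate = solve-∀

    twoStep-coefficients : ∀ Z → + twoStep Z ≡
      lowerCoefficient m (n C 2) i *ℤ + ⟦ E ⇝[ j ] Z ⟧ +ℤ
      (middleCoefficient (n C 2) i *ℤ + ⟦ E ⇝[ i ] Z ⟧ +ℤ upperCoefficient i *ℤ + ⟦ E ⇝[ suc i ] Z ⟧)
    twoStep-coefficients Z = trans (cong +_ (sumSubsets-twoStep E Z i))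
      (twoStepCount-coefficients j (∣ E ∩ Z ∣) (∣ E ∩ ∁ Z ∣) (∣ Z ∩ ∁ E ∣) (∣ ∁ E ∩ ∁ Z ∣) m≡ s≡)
      where
      m≡ : m ≡ ∣ E ∩ Z ∣ + ∣ E ∩ ∁ Z ∣
      m≡ = trans (sym ∣E∣≡m) (sym (∣∩∣+∣∩∁∣ E Z))
      s≡ : n C 2 ≡ ∣ E ∩ Z ∣ + ∣ E ∩ ∁ Z ∣ + ∣ Z ∩ ∁ E ∣ + ∣ ∁ E ∩ ∁ Z ∣
      s≡ = begin
        n C 2                                                     ≡⟨ S≡nC2 n ⟨
        S n                                                       ≡⟨ ∣∣+∣∁∣ E ⟨
        ∣ E ∣ + ∣ ∁ E ∣                                           ≡⟨ cong₂ _+_ (sym (∣∩∣+∣∩∁∣ E Z)) ∣∁E∣≡ ⟩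
        (∣ E ∩ Z ∣ + ∣ E ∩ ∁ Z ∣) + (∣ Z ∩ ∁ E ∣ + ∣ ∁ E ∩ ∁ Z ∣)  ≡⟨ +-assoc (∣ E ∩ Z ∣ + ∣ E ∩ ∁ Z ∣) _ _ ⟨
        ∣ E ∩ Z ∣ + ∣ E ∩ ∁ Z ∣ + ∣ Z ∩ ∁ E ∣ + ∣ ∁ E ∩ ∁ Z ∣      ∎
        where
        ∣∁E∣≡ : ∣ ∁ E ∣ ≡ ∣ Z ∩ ∁ E ∣ + ∣ ∁ E ∩ ∁ Z ∣
        ∣∁E∣≡ = trans (sym (∣∩∣+∣∩∁∣ (∁ E) Z)) (cong (λ x → ∣ x ∣ + ∣ ∁ E ∩ ∁ Z ∣) (∩-comm (∁ E) Z))

    recurrence : (D n m 1 ⊗ D n m i) k l ≡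
      ((lowerCoefficient m (n C 2) i ⊙ D n m j) ⊕
       ((middleCoefficient (n C 2) i ⊙ D n m i) ⊕ (upperCoefficient i ⊙ D n m (suc i)))) k l
    recurrence = begin
      (D n m 1 ⊗ D n m i) k l
        ≡⟨ foldr-pos (λ r → deckCount 1 F (rep r)) (λ r → deckCount i (rep r) G) (allFin (classCount n m)) ⟩
      + sumMap (λ r → deckCount 1 F (rep r) * deckCount i (rep r) G) (allFin (classCount n m))
        ≡⟨ cong +_ (sumMap-allFin-lookup (λ G′ → deckCount 1 F G′ * deckCount i G′ G) (classes n m)) ⟩
      + sumMap (λ G′ → deckCount 1 F G′ * deckCount i G′ G) (classes n m)
        ≡⟨ cong +_ product≡sumSubsets ⟩
      + sumSubsets (λ Z → ⟦ iso? (mkGraph Z) F ⟧ * twoStep Z)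
        ≡⟨ sumSubsets-linearℤ _ (deckSummand j) (deckSummand i) (deckSummand (suc i)) c₋ c₀ c₊ (λ Z →
             indicator-scale (iso? (mkGraph Z) F) (twoStep Z) ⟦ E ⇝[ j ] Z ⟧ ⟦ E ⇝[ i ] Z ⟧ ⟦ E ⇝[ suc i ] Z ⟧ c₋ c₀ c₊
                             (twoStep-coefficients Z)) ⟩
      c₋ *ℤ + sumSubsets (deckSummand j) +ℤ
      (c₀ *ℤ + sumSubsets (deckSummand i) +ℤ c₊ *ℤ + sumSubsets (deckSummand (suc i)))
        ≡⟨ cong₂ (λ x y → c₋ *ℤ + x +ℤ y) (deckCount≡sumSubsets j F G)
                 (cong₂ (λ x y → c₀ *ℤ + x +ℤ c₊ *ℤ + y) (deckCount≡sumSubsets i F G) (deckCount≡sumSubsets (suc i) F G)) ⟨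
      ((c₋ ⊙ D n m j) ⊕ ((c₀ ⊙ D n m i) ⊕ (c₊ ⊙ D n m (suc i)))) k l ∎
      where
      c₋ c₀ c₊ : ℤ
      c₋ = lowerCoefficient m (n C 2) i
      c₀ = middleCoefficient (n C 2) i
      c₊ = upperCoefficient i
      deckSummand : ℕ → Subset (S n) → ℕ
      deckSummand a Z = ⟦ E ⇝[ a ] Z ⟧ * ⟦ iso? (mkGraph Z) F ⟧

open import Data.Nat using (ℕ; _≤_; _∸_; _^_)
open import Data.Nat.Combinatorics using (_C_)
open import Data.Fin using (Fin)
open import Data.Integer using (ℤ; +_; _+_; _-_; _*_)
open import Relation.Binary.PropositionalEquality using (_≡_)
open import Data.Nat using (zero; suc)
open import Data.Nat.Properties using (+-comm)
open Recurrence using (module DeckProduct)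

theorem2p2 : (n m i : ℕ) → 1 ≤ n → m ≤ n C 2 → 1 ≤ i →
    (k l : Fin (classCount n m)) →
    (D n m 1 ⊗ D n m i) k l ≡
    (((((+ m - + i) + + 1) * ((+ (n C 2) - + m - + i) + + 1)) ⊙ D n m (i ∸ 1))
    ⊕ (((+ i * (+ (n C 2) - + 2 * + i)) ⊙ D n m i)
    ⊕ ((+ ((i Data.Nat.+ 1) ^ 2)) ⊙ D n m (i Data.Nat.+ 1)))) k l
theorem2p2 n m zero _ _ () k l
theorem2p2 n m (suc j) _ _ _ k l rewrite +-comm j 1 = DeckProduct.recurrence n m j k l
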